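{- For every $n\in\{2,4,6,\ldots\}$, $$\sum_{\substack{0\le k\le n\\ 4\mid k-2}}\binom nk(-1)^{\frac{k-2}4}2^{n-\frac k2}\cdot 3^kB_{n-k}=\frac n2\Big((-1)^{\lfloor\frac{n-2}4\rfloor}2^{\frac n2}\cdot 3^{n-1}+12U_{n-1}(2,10)\Big).$$
   Context: The Bernoulli numbers $B_n$ are defined by $B_0=1$ and $\sum_{k=0}^{n-1}\binom nkB_k=0$ for $n\ge 2$. For numbers $b,c$, the Lucas sequence $U_n(b,c)$ is defined by $U_0(b,c)=0$, $U_1(b,c)=1$, $U_{n+1}(b,c)=bU_n(b,c)-cU_{n-1}(b,c)$ for $n\ge1$. $\lfloor y\rfloor$ denotes the greatest integer not exceeding $y$. -}

module Defs where

open import Data.Nat as ℕ using (ℕ; zero; suc)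
open import Data.Nat.Combinatorics using (_C_)
open import Data.Integer as ℤ using (ℤ; +_)
open import Data.Rational as ℚ using (ℚ; _/_; 0ℚ; 1ℚ)
open import Data.List using (List; []; _∷_; _++_; [_]; foldr; zip; upTo; length)
open import Data.Fin using (Fin)

sumℚ : List ℚ → ℚ
sumℚ = foldr ℚ._+_ 0ℚ

-- bernoulliList m = [B_0, B_1, ..., B_m], computed from the defining
-- recurrence  sum_{k=0}^{N-1} (N choose k) B_k = 0  (N ≥ 2), solved for B_{N-1}:
--   B_{N-1} = -(1/N) * sum_{k=0}^{N-2} (N choose k) B_k.
bernoulliList : ℕ → List ℚ
bernoulliList zero = 1ℚ ∷ []
bernoulliList (suc m) =
  let bs = bernoulliList m
      N  = suc (suc m)
      s  = sumℚ (Data.List.map (λ p → (+ (N C Data.Product.proj₁ p) / 1) ℚ.* Data.Product.proj₂ p)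
                               (zip (upTo (suc m)) bs))
  in bs ++ [ ℚ.- ((+ 1 / N) ℚ.* s) ]
  where import Data.List ; import Data.Product

-- Bernoulli number B_n (so B_1 = -1/2).
lastOr : ℚ → List ℚ → ℚ
lastOr d [] = d
lastOr d (x ∷ xs) = lastOr x xs

B : ℕ → ℚ
B n = lastOr 0ℚ (bernoulliList n)

U : ℤ → ℤ → ℕ → ℤ
U b c zero = + 0
U b c (suc zero) = + 1
U b c (suc (suc n)) = b ℤ.* U b c (suc n) ℤ.- c ℤ.* U b c n

sgn : ℕ → ℤ
sgn zero = + 1
sgn (suc e) = ℤ.- sgn e

-- For natural k, 4 ∣ (k - 2) (in ℤ) iff k % 4 ≡ 2; then (k-2)/4 and k/2 are natural.
open import Data.Nat.DivMod using (_%_)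
open import Data.Bool using (if_then_else_)

lhsTerm : ℕ → ℕ → ℚ
lhsTerm n k =
  if k % 4 ℕ.≡ᵇ 2
  then (+ (n C k) / 1) ℚ.* ((sgn ((k ℕ.∸ 2) ℕ./ 4) ℤ.* (+ (2 ℕ.^ (n ℕ.∸ (k ℕ./ 2)) ℕ.* 3 ℕ.^ k))) / 1)
         ℚ.* B (n ℕ.∸ k)
  else 0ℚ

LHS : ℕ → ℚ
LHS n = sumℚ (Data.List.map (lhsTerm n) (upTo (suc n)))
  where import Data.List

RHS : ℕ → ℚ
RHS n = (+ n / 2) ℚ.* ((sgn ((n ℕ.∸ 2) ℕ./ 4) ℤ.* + (2 ℕ.^ (n ℕ./ 2) ℕ.* 3 ℕ.^ (n ℕ.∸ 1))
                         ℤ.+ + 12 ℤ.* U (+ 2) (+ 10) (n ℕ.∸ 1)) / 1)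

module Submission where

-- Let P_n(h, w) = ∑_j (n C j) B_(n-j) h^(n-j) w^j be the homogenised Bernoulli polynomial.
-- The recurrence defining the B_k says exactly that P_n(h, w + h) = P_n(h, w) + n h w^(n-1)
-- (expand (w + h)^(n-k) binomially and exchange the two sums).  In ℚ(i), with h = 2 and
-- Y = -3+3i, W₁ = -1+3i, W₂ = 1+3i, X = 3+3i, this telescopes to
--   P_n(2, X) - P_n(2, Y) = 2n (Y^(n-1) + W₁^(n-1) + W₂^(n-1)).
-- Take imaginary parts.  As X⁴ = Y⁴ = -324, Im X^k - Im Y^k vanishes unless k ≡ 2 (mod 4),
-- where it is 36 (-324)^((k-2)/4); so the left side becomes twice the LHS of the corollary.
-- On the right, W₂² = 2W₂ - 10 gives Im W₂^m = 3 U_m(2, 10), W₁ = -conj W₂ gives the same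
-- value for odd m, and Im Y^(n-1) is read off from Y⁴ = -324.

open import Defs
open import Algebra.Bundles using (CommutativeSemiring; CommutativeRing)
open import Level using (0ℓ)
open import Data.Nat as ℕ using (ℕ; zero; suc; _≤_; _<_; z≤n; s≤s; _∸_)
import Data.Nat.Properties as ℕ
open import Data.Nat.Divisibility using (_∣_; divides)
open import Data.Fin as Fin using (toℕ)
import Data.Fin.Properties as Fin
open import Data.List using ([]; _∷_; foldr; map; applyUpTo)
open import Function using (_∘_)
open import Relation.Binary.PropositionalEquality as ≡ using (_≡_)

module Arithmetic where
  open import Data.Nat as ℕ using (ℕ; zero; suc; _≤_; _<_; _+_; _*_; _∸_; _!; _^_; NonZero)
  open import Data.Nat.Properties
  open import Data.Nat.Combinatorics using (_C_; nCk≡n!/k![n-k]!; k![n∸k]!∣n!; k>n⇒nCk≡0; nCk≡nC[n∸k]; nC1≡n)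
  open import Data.Nat.DivMod using (_%_; _/_; m/n*n≡m; m*n/n≡m; m≡m%n+[m/n]*n; m%n<n)
  open import Relation.Nullary using (yes; no)
  open import Relation.Binary.PropositionalEquality
  open import Data.Nat.Solver using (module +-*-Solver)
  open +-*-Solver

  divMod-elim : ∀ {p} (P : ℕ → Set p) n .{{_ : NonZero n}} → (∀ r q → r < n → P (r + q * n)) → ∀ m → P m
  divMod-elim P n P[r+qn] m = subst P (sym (m≡m%n+[m/n]*n m n)) (P[r+qn] (m % n) (m / n) (m%n<n m n))

  nCk*k![n∸k]!≡n! : ∀ {n k} → k ≤ n → (n C k) * (k ! * (n ∸ k) !) ≡ n !
  nCk*k![n∸k]!≡n! {n} {k} k≤n =
    trans (cong (_* (k ! * (n ∸ k) !)) (nCk≡n!/k![n-k]! k≤n))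
          (m/n*n≡m {{k !* (n ∸ k) !≢0}} (k![n∸k]!∣n! k≤n))

  private
    ∸-swap : ∀ n k j → n ∸ k ∸ j ≡ n ∸ j ∸ k
    ∸-swap n k j = trans (∸-+-assoc n k j) (trans (cong (n ∸_) (+-comm k j)) (sym (∸-+-assoc n j k)))

    nCk*[n∸k]Cj*k!*j!*[n∸k∸j]!≡n! : ∀ {n} k j → k + j ≤ n →
      (n C k) * ((n ∸ k) C j) * (k ! * j ! * (n ∸ k ∸ j) !) ≡ n !
    nCk*[n∸k]Cj*k!*j!*[n∸k∸j]!≡n! {n} k j k+j≤n = begin
      (n C k) * ((n ∸ k) C j) * (k ! * j ! * (n ∸ k ∸ j) !)
        ≡⟨ solve 5 (λ a b c d e → a :* b :* (c :* d :* e) := a :* (b :* (d :* e) :* c)) refl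
          (n C k) ((n ∸ k) C j) (k !) (j !) ((n ∸ k ∸ j) !) ⟩
      (n C k) * (((n ∸ k) C j) * (j ! * (n ∸ k ∸ j) !) * k !)
        ≡⟨ cong (λ x → (n C k) * (x * k !)) (nCk*k![n∸k]!≡n! j≤n∸k) ⟩
      (n C k) * ((n ∸ k) ! * k !)
        ≡⟨ cong ((n C k) *_) (*-comm ((n ∸ k) !) (k !)) ⟩
      (n C k) * (k ! * (n ∸ k) !)
        ≡⟨ nCk*k![n∸k]!≡n! (m+n≤o⇒m≤o k k+j≤n) ⟩
      n !                                                          ∎
      where
      open ≡-Reasoning
      j≤n∸k : j ≤ n ∸ k
      j≤n∸k = subst (_≤ n ∸ k) (m+n∸m≡n k j) (∸-monoˡ-≤ k k+j≤n)

  nCk*[n∸k]Cj≡nCj*[n∸j]Ck : ∀ {n} k j → k + j ≤ n → (n C k) * ((n ∸ k) C j) ≡ (n C j) * ((n ∸ j) C k)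
  nCk*[n∸k]Cj≡nCj*[n∸j]Ck {n} k j k+j≤n =
    *-cancelʳ-≡ _ _ (k ! * j ! * (n ∸ k ∸ j) !) {{m*n≢0 _ _ {{m*n≢0 _ _ {{k !≢0}} {{j !≢0}}}} {{(n ∸ k ∸ j) !≢0}}}} (begin
      (n C k) * ((n ∸ k) C j) * (k ! * j ! * (n ∸ k ∸ j) !)
        ≡⟨ nCk*[n∸k]Cj*k!*j!*[n∸k∸j]!≡n! k j k+j≤n ⟩
      n !
        ≡⟨ nCk*[n∸k]Cj*k!*j!*[n∸k∸j]!≡n! j k (subst (_≤ n) (+-comm k j) k+j≤n) ⟨
      (n C j) * ((n ∸ j) C k) * (j ! * k ! * (n ∸ j ∸ k) !)
        ≡⟨ cong₂ (λ x y → (n C j) * ((n ∸ j) C k) * (x * y !)) (*-comm (j !) (k !)) (∸-swap n j k) ⟩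
      (n C j) * ((n ∸ j) C k) * (k ! * j ! * (n ∸ k ∸ j) !)   ∎)
    where open ≡-Reasoning

  nCk*[n∸k]Cj≡0 : ∀ {n} k j → n < k + j → (n C k) * ((n ∸ k) C j) ≡ 0
  nCk*[n∸k]Cj≡0 {n} k j n<k+j with k ℕ.≤? n
  ... | no k≰n = cong (_* ((n ∸ k) C j)) (k>n⇒nCk≡0 (≰⇒> k≰n))
  ... | yes k≤n = trans (cong ((n C k) *_) (k>n⇒nCk≡0 n∸k<j)) (*-zeroʳ (n C k))
    where
    n∸k<j : n ∸ k < j
    n∸k<j = ≰⇒> (λ j≤n∸k → <⇒≱ n<k+j (subst (k + j ≤_) (m+[n∸m]≡n k≤n) (+-monoʳ-≤ k j≤n∸k)))

  k+[n∸k∸j]≡n∸j : ∀ {n} k j → k + j ≤ n → k + (n ∸ k ∸ j) ≡ n ∸ j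
  k+[n∸k∸j]≡n∸j {n} k j k+j≤n = trans (cong (k +_) (∸-swap n k j)) (m+[n∸m]≡n k≤n∸j)
    where
    k≤n∸j : k ≤ n ∸ j
    k≤n∸j = subst (_≤ n ∸ j) (m+n∸n≡m k j) (∸-monoˡ-≤ j k+j≤n)

  [2+4q]/2≡1+2q : ∀ q → (2 + q * 4) / 2 ≡ 1 + q * 2
  [2+4q]/2≡1+2q q = trans (cong (_/ 2) (solve 1 (λ q → con 2 :+ q :* con 4 := (con 1 :+ q :* con 2) :* con 2) refl q))
                          (m*n/n≡m (1 + q * 2) 2)

  [1+n]Cn≡1+n : ∀ n → suc n C n ≡ suc n
  [1+n]Cn≡1+n n = trans (nCk≡nC[n∸k] (n≤1+n n)) (trans (cong (suc n C_) (m+n∸n≡m 1 n)) (nC1≡n (suc n)))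

  324^q≡2^[2q]*3^[4q] : ∀ q → 324 ^ q ≡ 2 ^ (q * 2) * 3 ^ (q * 4)
  324^q≡2^[2q]*3^[4q] zero = refl
  324^q≡2^[2q]*3^[4q] (suc q) = begin
    324 * 324 ^ q
      ≡⟨ cong (324 *_) (324^q≡2^[2q]*3^[4q] q) ⟩
    324 * (2 ^ (q * 2) * 3 ^ (q * 4))
      ≡⟨ solve 2 (λ a b → con 324 :* (a :* b) := con 2 :* (con 2 :* a) :* (con 3 :* (con 3 :* (con 3 :* (con 3 :* b))))) refl (2 ^ (q * 2)) (3 ^ (q * 4)) ⟩
    2 ^ (suc q * 2) * 3 ^ (suc q * 4)               ∎
    where open ≡-Reasoning

  n∸[1+2q]≡n∸[2+4q]+[1+2q] : ∀ {n} q → 2 + q * 4 ≤ n → n ∸ (1 + q * 2) ≡ n ∸ (2 + q * 4) + (1 + q * 2)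
  n∸[1+2q]≡n∸[2+4q]+[1+2q] {n} q le = begin
    n ∸ a
      ≡⟨ cong (_∸ a) (m∸n+n≡m le) ⟨
    e + (2 + q * 4) ∸ a
      ≡⟨ cong (λ t → e + t ∸ a) (solve 1 (λ q → con 2 :+ q :* con 4 := (con 1 :+ q :* con 2) :+ (con 1 :+ q :* con 2)) refl q) ⟩
    e + (a + a) ∸ a
      ≡⟨ cong (_∸ a) (+-assoc e a a) ⟨
    e + a + a ∸ a
      ≡⟨ m+n∸n≡m (e + a) a ⟩
    e + a                        ∎
    where
    open ≡-Reasoning
    a = 1 + q * 2
    e = n ∸ (2 + q * 4)

  36*2^[n∸[2+4q]]*324^q≡2*2^[n∸[1+2q]]*3^[2+4q] : ∀ {n} q → 2 + q * 4 ≤ n →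
    36 * 2 ^ (n ∸ (2 + q * 4)) * 324 ^ q ≡ 2 * (2 ^ (n ∸ (1 + q * 2)) * 3 ^ (2 + q * 4))
  36*2^[n∸[2+4q]]*324^q≡2*2^[n∸[1+2q]]*3^[2+4q] {n} q le = begin
    36 * 2 ^ e * 324 ^ q
      ≡⟨ cong (36 * 2 ^ e *_) (324^q≡2^[2q]*3^[4q] q) ⟩
    36 * 2 ^ e * (2 ^ (q * 2) * 3 ^ (q * 4))
      ≡⟨ solve 3 (λ x a b → con 36 :* x :* (a :* b) := con 2 :* (x :* (con 2 :* a) :* (con 3 :* (con 3 :* b)))) refl (2 ^ e) (2 ^ (q * 2)) (3 ^ (q * 4)) ⟩
    2 * (2 ^ e * 2 ^ (1 + q * 2) * 3 ^ (2 + q * 4))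
      ≡⟨ cong (λ t → 2 * (t * 3 ^ (2 + q * 4))) (^-distribˡ-+-* 2 e (1 + q * 2)) ⟨
    2 * (2 ^ (e + (1 + q * 2)) * 3 ^ (2 + q * 4))
      ≡⟨ cong (λ t → 2 * (2 ^ t * 3 ^ (2 + q * 4))) (n∸[1+2q]≡n∸[2+4q]+[1+2q] q le) ⟨
    2 * (2 ^ (n ∸ (1 + q * 2)) * 3 ^ (2 + q * 4))                ∎
    where
    open ≡-Reasoning
    e = n ∸ (2 + q * 4)

module IntegersInRationals where
  open Arithmetic using (36*2^[n∸[2+4q]]*324^q≡2*2^[n∸[1+2q]]*3^[2+4q])
  open import Data.Nat as ℕ using (ℕ; zero; suc)
  import Data.Nat.Properties as ℕ
  import Data.Integer.Properties as ℤ
  open import Data.Integer as ℤ using (ℤ; +_)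
  open import Data.Rational as ℚ using (ℚ; _/_; 1ℚ)
  import Data.Rational.Properties as ℚ
  open import Data.Rational.Unnormalised as ℚᵘ using (mkℚᵘ; *≡*)
  import Data.Rational.Unnormalised.Properties as ℚᵘ
  open import Data.Integer.Solver using (module +-*-Solver)
  open import Relation.Binary.PropositionalEquality
  open ≡-Reasoning

  -[a]^q≡sgn[q]*a^q : ∀ a q → (ℤ.- + a) ℤ.^ q ≡ sgn q ℤ.* + (a ℕ.^ q)
  -[a]^q≡sgn[q]*a^q a zero = refl
  -[a]^q≡sgn[q]*a^q a (suc q) = begin
    (ℤ.- + a) ℤ.* (ℤ.- + a) ℤ.^ q
      ≡⟨ cong ((ℤ.- + a) ℤ.*_) (-[a]^q≡sgn[q]*a^q a q) ⟩
    (ℤ.- + a) ℤ.* (sgn q ℤ.* + (a ℕ.^ q))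
      ≡⟨ solve 3 (λ a s x → (:- a) :* (s :* x) := (:- s) :* (a :* x)) refl (+ a) (sgn q) (+ (a ℕ.^ q)) ⟩
    ℤ.- sgn q ℤ.* (+ a ℤ.* + (a ℕ.^ q))
      ≡⟨ cong (ℤ.- sgn q ℤ.*_) (ℤ.pos-* a (a ℕ.^ q)) ⟨
    sgn (suc q) ℤ.* + (a ℕ.^ suc q)            ∎
    where open +-*-Solver

  36*2^[n∸[2+4q]]*[-324]^q≡2*sgn[q]*2^[n∸[1+2q]]*3^[2+4q] : ∀ {n} q → 2 ℕ.+ q ℕ.* 4 ℕ.≤ n →
    + 36 ℤ.* + (2 ℕ.^ (n ℕ.∸ (2 ℕ.+ q ℕ.* 4))) ℤ.* (ℤ.- + 324) ℤ.^ q
      ≡ + 2 ℤ.* (sgn q ℤ.* + (2 ℕ.^ (n ℕ.∸ (1 ℕ.+ q ℕ.* 2)) ℕ.* 3 ℕ.^ (2 ℕ.+ q ℕ.* 4)))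
  36*2^[n∸[2+4q]]*[-324]^q≡2*sgn[q]*2^[n∸[1+2q]]*3^[2+4q] {n} q j≤n = begin
      + 36 ℤ.* + (2 ℕ.^ e) ℤ.* (ℤ.- + 324) ℤ.^ q
        ≡⟨ cong (+ 36 ℤ.* + (2 ℕ.^ e) ℤ.*_) (-[a]^q≡sgn[q]*a^q 324 q) ⟩
      + 36 ℤ.* + (2 ℕ.^ e) ℤ.* (sgn q ℤ.* + (324 ℕ.^ q))
        ≡⟨ solve 4 (λ a b s c → a :* b :* (s :* c) := s :* (a :* b :* c)) refl (+ 36) (+ (2 ℕ.^ e)) (sgn q) (+ (324 ℕ.^ q)) ⟩
      sgn q ℤ.* (+ 36 ℤ.* + (2 ℕ.^ e) ℤ.* + (324 ℕ.^ q))
        ≡⟨ cong (λ x → sgn q ℤ.* (x ℤ.* + (324 ℕ.^ q))) (ℤ.pos-* 36 (2 ℕ.^ e)) ⟨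
      sgn q ℤ.* (+ (36 ℕ.* 2 ℕ.^ e) ℤ.* + (324 ℕ.^ q))
        ≡⟨ cong (sgn q ℤ.*_) (ℤ.pos-* (36 ℕ.* 2 ℕ.^ e) (324 ℕ.^ q)) ⟨
      sgn q ℤ.* + (36 ℕ.* 2 ℕ.^ e ℕ.* 324 ℕ.^ q)
        ≡⟨ cong (λ x → sgn q ℤ.* + x) (36*2^[n∸[2+4q]]*324^q≡2*2^[n∸[1+2q]]*3^[2+4q] q j≤n) ⟩
      sgn q ℤ.* + (2 ℕ.* M)
        ≡⟨ cong (sgn q ℤ.*_) (ℤ.pos-* 2 M) ⟩
      sgn q ℤ.* (+ 2 ℤ.* + M)
        ≡⟨ solve 3 (λ s a m → s :* (a :* m) := a :* (s :* m)) refl (sgn q) (+ 2) (+ M) ⟩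
      + 2 ℤ.* K                                             ∎
    where
    open +-*-Solver
    e = n ℕ.∸ (2 ℕ.+ q ℕ.* 4)
    M = 2 ℕ.^ (n ℕ.∸ (1 ℕ.+ q ℕ.* 2)) ℕ.* 3 ℕ.^ (2 ℕ.+ q ℕ.* 4)
    K = sgn q ℤ.* + M

  fromℤ : ℤ → ℚ
  fromℤ i = i / 1

  private
    toℚᵘ-/ : ∀ i d → ℚ.toℚᵘ (i / suc d) ℚᵘ.≃ mkℚᵘ i d
    toℚᵘ-/ i d = ℚ.toℚᵘ-fromℚᵘ (mkℚᵘ i d)

  fromℤ-homo-+ : ∀ a b → fromℤ (a ℤ.+ b) ≡ fromℤ a ℚ.+ fromℤ b
  fromℤ-homo-+ a b = ℚ.toℚᵘ-injective (ℚᵘ.≃-trans (toℚᵘ-/ (a ℤ.+ b) 0) (ℚᵘ.≃-trans (*≡* eq)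
    (ℚᵘ.≃-sym (ℚᵘ.≃-trans (ℚ.toℚᵘ-homo-+ (fromℤ a) (fromℤ b)) (ℚᵘ.+-cong (toℚᵘ-/ a 0) (toℚᵘ-/ b 0))))))
    where
    open +-*-Solver
    eq : (a ℤ.+ b) ℤ.* + 1 ≡ (a ℤ.* + 1 ℤ.+ b ℤ.* + 1) ℤ.* + 1
    eq = solve 2 (λ a b → (a :+ b) :* con (+ 1) := (a :* con (+ 1) :+ b :* con (+ 1)) :* con (+ 1)) refl a b

  fromℤ-homo-* : ∀ a b → fromℤ (a ℤ.* b) ≡ fromℤ a ℚ.* fromℤ b
  fromℤ-homo-* a b = ℚ.toℚᵘ-injective (ℚᵘ.≃-trans (toℚᵘ-/ (a ℤ.* b) 0)
    (ℚᵘ.≃-sym (ℚᵘ.≃-trans (ℚ.toℚᵘ-homo-* (fromℤ a) (fromℤ b)) (ℚᵘ.*-cong (toℚᵘ-/ a 0) (toℚᵘ-/ b 0)))))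

  fromℤ-homo‿- : ∀ a → fromℤ (ℤ.- a) ≡ ℚ.- fromℤ a
  fromℤ-homo‿- a = ℚ.toℚᵘ-injective (ℚᵘ.≃-trans (toℚᵘ-/ (ℤ.- a) 0)
    (ℚᵘ.≃-sym (ℚᵘ.≃-trans (ℚ.toℚᵘ-homo‿- (fromℤ a)) (ℚᵘ.-‿cong (toℚᵘ-/ a 0)))))

  /-≡-fromℤ-* : ∀ i d → i / suc d ≡ fromℤ i ℚ.* (+ 1 / suc d)
  /-≡-fromℤ-* i d = ℚ.toℚᵘ-injective (ℚᵘ.≃-trans (toℚᵘ-/ i d)
    (ℚᵘ.≃-sym (ℚᵘ.≃-trans (ℚ.toℚᵘ-homo-* (fromℤ i) (+ 1 / suc d)) (ℚᵘ.≃-trans (ℚᵘ.*-cong (toℚᵘ-/ i 0) (toℚᵘ-/ (+ 1) d)) (*≡* eq)))))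
    where
    eq : (i ℤ.* + 1) ℤ.* + suc d ≡ i ℤ.* + suc (d ℕ.+ 0)
    eq = cong₂ (λ x y → x ℤ.* + suc y) (ℤ.*-identityʳ i) (sym (ℕ.+-identityʳ d))

  [1+d]/[1+d]≡1 : ∀ d → + suc d / suc d ≡ 1ℚ
  [1+d]/[1+d]≡1 d = ℚ.toℚᵘ-injective (ℚᵘ.≃-trans (toℚᵘ-/ (+ suc d) d) (*≡* (ℤ.*-comm (+ suc d) (+ 1))))

module RangeSum {c ℓ} (R : CommutativeSemiring c ℓ) where

  open CommutativeSemiring R
  open import Algebra.Properties.Semiring.Sum semiring
    using (sum; sum-cong-≋; sum-replicate-zero; sum-init-last; ∑-distrib-+; ∑-comm; *-distribˡ-sum)
  open import Relation.Binary.Reasoning.Setoid setoid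

  -- Opaque, so that unification recovers f from ∑ℕ n f.
  opaque
    ∑ℕ : ℕ → (ℕ → Carrier) → Carrier
    ∑ℕ n f = sum {n} (f ∘ toℕ)

    sum∘toℕ≡∑ℕ : ∀ n f → sum {n} (f ∘ toℕ) ≡.≡ ∑ℕ n f
    sum∘toℕ≡∑ℕ n f = ≡.refl

    ∑ℕ-suc-head : ∀ n f → ∑ℕ (suc n) f ≡.≡ f 0 + ∑ℕ n (f ∘ suc)
    ∑ℕ-suc-head n f = ≡.refl

    ∑ℕ-0 : ∀ f → ∑ℕ 0 f ≡.≡ 0#
    ∑ℕ-0 f = ≡.refl

    ∑ℕ-applyUpTo : ∀ {a} {A : Set a} (g : A → Carrier) f n → foldr _+_ 0# (map g (applyUpTo f n)) ≡.≡ ∑ℕ n (g ∘ f)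
    ∑ℕ-applyUpTo g f zero = ≡.refl
    ∑ℕ-applyUpTo g f (suc n) = ≡.cong (g (f 0) +_) (∑ℕ-applyUpTo g (f ∘ suc) n)

    ∑ℕ-cong : ∀ {n f g} → (∀ {i} → i < n → f i ≈ g i) → ∑ℕ n f ≈ ∑ℕ n g
    ∑ℕ-cong {n} f≈g = sum-cong-≋ {n} (λ i → f≈g (Fin.toℕ<n i))

    ∑ℕ-distrib-+ : ∀ n (f g : ℕ → Carrier) → ∑ℕ n (λ i → f i + g i) ≈ ∑ℕ n f + ∑ℕ n g
    ∑ℕ-distrib-+ n f g = ∑-distrib-+ {n} (f ∘ toℕ) (g ∘ toℕ)

    *-distribˡ-∑ℕ : ∀ n x (f : ℕ → Carrier) → x * ∑ℕ n f ≈ ∑ℕ n (λ i → x * f i)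
    *-distribˡ-∑ℕ n x f = *-distribˡ-sum {n} x (f ∘ toℕ)

    ∑ℕ-comm : ∀ m n (f : ℕ → ℕ → Carrier) → ∑ℕ m (λ i → ∑ℕ n (f i)) ≈ ∑ℕ n (λ j → ∑ℕ m (λ i → f i j))
    ∑ℕ-comm m n f = ∑-comm {m} {n} (λ i j → f (toℕ i) (toℕ j))

    ∑ℕ-zero : ∀ {n f} → (∀ {i} → i < n → f i ≈ 0#) → ∑ℕ n f ≈ 0#
    ∑ℕ-zero {n} f≈0 = trans (∑ℕ-cong f≈0) (sum-replicate-zero n)

    ∑ℕ-suc : ∀ n f → ∑ℕ (suc n) f ≈ ∑ℕ n f + f n
    ∑ℕ-suc n f = begin
      ∑ℕ (suc n) f
        ≈⟨ sum-init-last {n} (f ∘ toℕ) ⟩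
      sum {n} (f ∘ toℕ ∘ Fin.inject₁) + f (toℕ (Fin.fromℕ n))
        ≈⟨ +-cong (sum-cong-≋ {n} (λ i → reflexive (≡.cong f (Fin.toℕ-inject₁ i))))
          (reflexive (≡.cong f (Fin.toℕ-fromℕ n))) ⟩
      ∑ℕ n f + f n                                   ∎

    ∑ℕ-extend : ∀ {m n f} → m ≤ n → (∀ {i} → m ≤ i → f i ≈ 0#) → ∑ℕ n f ≈ ∑ℕ m f
    ∑ℕ-extend {n = n} {f} z≤n f≈0 = ∑ℕ-zero {n} {f} (λ _ → f≈0 z≤n)
    ∑ℕ-extend (s≤s m≤n) f≈0 = +-congˡ (∑ℕ-extend m≤n (λ m≤i → f≈0 (s≤s m≤i)))

    ∑ℕ-reverse : ∀ n f → ∑ℕ n f ≈ ∑ℕ n (λ i → f (n ∸ suc i))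
    ∑ℕ-reverse zero f = refl
    ∑ℕ-reverse (suc n) f = begin
      f 0 + ∑ℕ n (f ∘ suc)                      ≈⟨ +-congˡ (∑ℕ-reverse n (f ∘ suc)) ⟩
      f 0 + ∑ℕ n (λ i → f (suc (n ∸ suc i)))    ≈⟨ +-comm _ _ ⟩
      ∑ℕ n (λ i → f (suc (n ∸ suc i))) + f 0    ≈⟨ +-cong (∑ℕ-cong {n} (λ i<n → reflexive (≡.cong f (≡.sym (ℕ.+-∸-assoc 1 i<n)))))
                                                          (reflexive (≡.cong f (≡.sym (ℕ.n∸n≡0 n)))) ⟩
      ∑ℕ n (λ i → f (n ∸ i)) + f (n ∸ n)        ≈⟨ sym (∑ℕ-suc n (λ i → f (n ∸ i))) ⟩
      ∑ℕ (suc n) (λ i → f (n ∸ i))              ∎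

module RangeSumHomomorphism {c₁ c₂ ℓ₁ ℓ₂} (R : CommutativeSemiring c₁ ℓ₁) (S : CommutativeSemiring c₂ ℓ₂) where

  private
    module R = CommutativeSemiring R
    module S = CommutativeSemiring S
    module ΣR = RangeSum R
    module ΣS = RangeSum S

  ∑ℕ-homo : (φ : R.Carrier → S.Carrier) → φ R.0# S.≈ S.0# → (∀ x y → φ (x R.+ y) S.≈ φ x S.+ φ y) →
            ∀ n f → φ (ΣR.∑ℕ n f) S.≈ ΣS.∑ℕ n (φ ∘ f)
  ∑ℕ-homo φ φ-0 φ-+ zero f = S.trans (S.reflexive (≡.cong φ (ΣR.∑ℕ-0 f))) (S.trans φ-0 (S.reflexive (≡.sym (ΣS.∑ℕ-0 (φ ∘ f)))))
  ∑ℕ-homo φ φ-0 φ-+ (suc n) f = begin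
    φ (ΣR.∑ℕ (suc n) f)                   ≡⟨ ≡.cong φ (ΣR.∑ℕ-suc-head n f) ⟩
    φ (f 0 R.+ ΣR.∑ℕ n (f ∘ suc))         ≈⟨ φ-+ (f 0) _ ⟩
    φ (f 0) S.+ φ (ΣR.∑ℕ n (f ∘ suc))     ≈⟨ S.+-congˡ (∑ℕ-homo φ φ-0 φ-+ n (f ∘ suc)) ⟩
    φ (f 0) S.+ ΣS.∑ℕ n (φ ∘ f ∘ suc)     ≡⟨ ΣS.∑ℕ-suc-head n (φ ∘ f) ⟨
    ΣS.∑ℕ (suc n) (φ ∘ f)                 ∎
    where open import Relation.Binary.Reasoning.Setoid S.setoid

module BernoulliPolynomial {c ℓ} (R : CommutativeSemiring c ℓ) where

  open CommutativeSemiring R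
  open RangeSum R
  open import Algebra.Properties.Semiring.Exp semiring using (_^_; ^-homo-*)
  open import Algebra.Properties.Semiring.Mult semiring using (_×_; ×-congʳ; ×-assoc-*; ×1-homo-*)
  open import Algebra.Properties.CommutativeSemiring.Binomial R using () renaming (theorem to binomial-theorem)
  open import Algebra.Solver.Ring.NaturalCoefficients.Default R using (solve; _:=_; _:+_; _:*_; con)
  open import Data.Nat.Combinatorics using (_C_; nCk≡nC[n∸k]; k>n⇒nCk≡0)
  open Arithmetic
  open import Relation.Nullary using (yes; no)
  open import Relation.Binary.Reasoning.Setoid setoid

  ⟦_⟧ : ℕ → Carrier
  ⟦ n ⟧ = n × 1#

  δ₁ : ℕ → Carrier
  δ₁ 1 = 1#
  δ₁ _ = 0#

  -- The recurrence ∑_(k<m) (m C k) B_k = 0 (m ≥ 2) together with B₀ = 1 (the case m = 1),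
  -- written as one identity for all m.
  IsBernoulli : (ℕ → Carrier) → Set ℓ
  IsBernoulli b = ∀ m → ∑ℕ (suc m) (λ k → ⟦ m C k ⟧ * b k) ≈ b m + δ₁ m

  -- h^n B_n(w / h) for the Bernoulli polynomial B_n(x) = ∑_j (n C j) B_(n-j) x^j.
  bernoulliPoly : (ℕ → Carrier) → ℕ → Carrier → Carrier → Carrier
  bernoulliPoly b n h w = ∑ℕ (suc n) (λ j → ⟦ n C j ⟧ * b (n ∸ j) * h ^ (n ∸ j) * w ^ j)

  binomial-theorem-∑ℕ : ∀ n x y → (x + y) ^ n ≈ ∑ℕ (suc n) (λ j → ⟦ n C j ⟧ * (x ^ j * y ^ (n ∸ j)))
  binomial-theorem-∑ℕ n x y = begin
    (x + y) ^ n                                          ≈⟨ binomial-theorem n x y ⟩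
    _                                                    ≡⟨ sum∘toℕ≡∑ℕ (suc n) (λ j → (n C j) × (x ^ j * y ^ (n ∸ j))) ⟩
    ∑ℕ (suc n) (λ j → (n C j) × (x ^ j * y ^ (n ∸ j)))  ≈⟨ ∑ℕ-cong {suc n} (λ {j} _ → let t = x ^ j * y ^ (n ∸ j) in
                          trans (×-congʳ (n C j) (sym (*-identityˡ t))) (sym (×-assoc-* (n C j) 1# t))) ⟩
    ∑ℕ (suc n) (λ j → ⟦ n C j ⟧ * (x ^ j * y ^ (n ∸ j)))  ∎

  bernoulliPoly-reversed : ∀ b n h w → bernoulliPoly b n h w ≈ ∑ℕ (suc n) (λ k → ⟦ n C k ⟧ * b k * h ^ k * w ^ (n ∸ k))
  bernoulliPoly-reversed b n h w = trans (∑ℕ-reverse (suc n) _) (∑ℕ-cong {suc n} (λ {k} k<1+n →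
    let k≤n = ℕ.≤-pred k<1+n in
    reflexive (≡.cong₂ (λ c e → ⟦ c ⟧ * b e * h ^ e * w ^ (n ∸ k)) (≡.sym (nCk≡nC[n∸k] k≤n)) (ℕ.m∸[m∸n]≡n k≤n))))

  private
    ⟦0⟧*x≈0 : ∀ {m} x → m ≡.≡ 0 → ⟦ m ⟧ * x ≈ 0#
    ⟦0⟧*x≈0 x ≡.refl = zeroˡ x

  private
    δ₁-vanishes : ∀ {m j} → j < m → δ₁ (suc m ∸ j) ≡.≡ 0#
    δ₁-vanishes {suc m} {zero} _ = ≡.refl
    δ₁-vanishes {suc m} {suc j} (s≤s j<m) = δ₁-vanishes j<m

    δ₁-sum : ∀ m h w →
      ∑ℕ (suc (suc m)) (λ j → ⟦ suc m C j ⟧ * (w ^ j * h ^ (suc m ∸ j)) * δ₁ (suc m ∸ j)) ≈ ⟦ suc m ⟧ * (h * w ^ m)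
    δ₁-sum m h w = begin
      ∑ℕ (suc (suc m)) f
        ≈⟨ ∑ℕ-suc (suc m) f ⟩
      ∑ℕ (suc m) f + f (suc m)
        ≈⟨ +-congʳ (∑ℕ-suc m f) ⟩
      ∑ℕ m f + f m + f (suc m)
        ≈⟨ +-cong (+-cong (∑ℕ-zero (λ j<m → trans (*-congˡ (reflexive (δ₁-vanishes j<m))) (zeroʳ _))) fm≈)
          (trans (*-congˡ (reflexive (≡.cong δ₁ (ℕ.n∸n≡0 m)))) (zeroʳ _)) ⟩
      0# + ⟦ suc m ⟧ * (w ^ m * (h * 1#)) * 1# + 0#
        ≈⟨ solve 3 (λ a x y → con 0 :+ a :* (x :* (y :* con 1)) :* con 1 :+ con 0 := a :* (y :* x)) refl
          ⟦ suc m ⟧ (w ^ m) h ⟩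
      ⟦ suc m ⟧ * (h * w ^ m)         ∎
      where
      f : ℕ → Carrier
      f j = ⟦ suc m C j ⟧ * (w ^ j * h ^ (suc m ∸ j)) * δ₁ (suc m ∸ j)
      1+m∸m≡1 : suc m ∸ m ≡.≡ 1
      1+m∸m≡1 = ℕ.m+n∸n≡m 1 m
      fm≈ : f m ≈ ⟦ suc m ⟧ * (w ^ m * (h * 1#)) * 1#
      fm≈ = reflexive (≡.cong₂ (λ c e → ⟦ c ⟧ * (w ^ m * h ^ e) * δ₁ e) ([1+n]Cn≡1+n m) 1+m∸m≡1)

  private module ShiftedExpansion {b : ℕ → Carrier} (b-isBernoulli : IsBernoulli b) (n : ℕ) (h w : Carrier) where

    private
      T S : ℕ → ℕ → Carrier
      T k j = ⟦ n C k ⟧ * b k * h ^ k * (⟦ (n ∸ k) C j ⟧ * (w ^ j * h ^ (n ∸ k ∸ j)))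
      S j k = ⟦ n C j ⟧ * (w ^ j * h ^ (n ∸ j)) * (⟦ (n ∸ j) C k ⟧ * b k)

    binomial-expand : ∀ k → ⟦ n C k ⟧ * b k * h ^ k * (w + h) ^ (n ∸ k) ≈ ∑ℕ (suc n) (T k)
    binomial-expand k = begin
      ⟦ n C k ⟧ * b k * h ^ k * (w + h) ^ (n ∸ k)  ≈⟨ *-congˡ (binomial-theorem-∑ℕ (n ∸ k) w h) ⟩
      ⟦ n C k ⟧ * b k * h ^ k * ∑ℕ (suc (n ∸ k)) binomialTerm  ≈⟨ *-distribˡ-∑ℕ (suc (n ∸ k)) _ binomialTerm ⟩
      ∑ℕ (suc (n ∸ k)) (T k)                       ≈⟨ ∑ℕ-extend (s≤s (ℕ.m∸n≤m n k)) vanish ⟨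
      ∑ℕ (suc n) (T k)                             ∎
      where
      binomialTerm : ℕ → Carrier
      binomialTerm j = ⟦ (n ∸ k) C j ⟧ * (w ^ j * h ^ (n ∸ k ∸ j))
      vanish : ∀ {j} → suc (n ∸ k) ≤ j → T k j ≈ 0#
      vanish {j} n∸k<j = trans (*-congˡ (⟦0⟧*x≈0 _ (k>n⇒nCk≡0 n∸k<j))) (zeroʳ _)

    binomial-swap : ∀ k j → T k j ≈ S j k
    binomial-swap k j = begin
      T k j
        ≈⟨ solve 6 (λ a b′ x c y z → a :* b′ :* x :* (c :* (y :* z)) := a :* c :* (b′ :* y :* (x :* z))) refl
          ⟦ n C k ⟧ (b k) (h ^ k) ⟦ (n ∸ k) C j ⟧ (w ^ j) (h ^ (n ∸ k ∸ j)) ⟩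
      ⟦ n C k ⟧ * ⟦ (n ∸ k) C j ⟧ * (b k * w ^ j * (h ^ k * h ^ (n ∸ k ∸ j)))
        ≈⟨ *-cong (sym (×1-homo-* (n C k) ((n ∸ k) C j))) (*-congˡ (sym (^-homo-* h k (n ∸ k ∸ j)))) ⟩
      ⟦ (n C k) ℕ.* ((n ∸ k) C j) ⟧ * (b k * w ^ j * h ^ (k ℕ.+ (n ∸ k ∸ j)))
        ≈⟨ reindex ⟩
      ⟦ (n C j) ℕ.* ((n ∸ j) C k) ⟧ * (b k * w ^ j * h ^ (n ∸ j))
        ≈⟨ *-congʳ (×1-homo-* (n C j) ((n ∸ j) C k)) ⟩
      ⟦ n C j ⟧ * ⟦ (n ∸ j) C k ⟧ * (b k * w ^ j * h ^ (n ∸ j))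
        ≈⟨ solve 5 (λ a c b′ y z → a :* c :* (b′ :* y :* z) := a :* (y :* z) :* (c :* b′)) refl
          ⟦ n C j ⟧ ⟦ (n ∸ j) C k ⟧ (b k) (w ^ j) (h ^ (n ∸ j)) ⟩
      S j k                                                          ∎
      where
      reindex : ⟦ (n C k) ℕ.* ((n ∸ k) C j) ⟧ * (b k * w ^ j * h ^ (k ℕ.+ (n ∸ k ∸ j)))
              ≈ ⟦ (n C j) ℕ.* ((n ∸ j) C k) ⟧ * (b k * w ^ j * h ^ (n ∸ j))
      reindex with k ℕ.+ j ℕ.≤? n
      ... | yes k+j≤n = reflexive (≡.cong₂ (λ c e → ⟦ c ⟧ * (b k * w ^ j * h ^ e))
                                           (nCk*[n∸k]Cj≡nCj*[n∸j]Ck k j k+j≤n) (k+[n∸k∸j]≡n∸j k j k+j≤n))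
      ... | no k+j≰n = trans (⟦0⟧*x≈0 _ (nCk*[n∸k]Cj≡0 k j n<k+j))
                             (sym (⟦0⟧*x≈0 _ (nCk*[n∸k]Cj≡0 j k (≡.subst (n ℕ.<_) (ℕ.+-comm k j) n<k+j))))
        where n<k+j = ℕ.≰⇒> k+j≰n

    bernoulli-inner-sum : ∀ j → ∑ℕ (suc n) (S j) ≈ ⟦ n C j ⟧ * (w ^ j * h ^ (n ∸ j)) * (b (n ∸ j) + δ₁ (n ∸ j))
    bernoulli-inner-sum j = begin
      ∑ℕ (suc n) (S j)
        ≈⟨ *-distribˡ-∑ℕ (suc n) _ _ ⟨
      ⟦ n C j ⟧ * (w ^ j * h ^ (n ∸ j)) * ∑ℕ (suc n) (λ k → ⟦ (n ∸ j) C k ⟧ * b k)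
        ≈⟨ *-congˡ (∑ℕ-extend (s≤s (ℕ.m∸n≤m n j)) vanish) ⟩
      ⟦ n C j ⟧ * (w ^ j * h ^ (n ∸ j)) * ∑ℕ (suc (n ∸ j)) (λ k → ⟦ (n ∸ j) C k ⟧ * b k)
        ≈⟨ *-congˡ (b-isBernoulli (n ∸ j)) ⟩
      ⟦ n C j ⟧ * (w ^ j * h ^ (n ∸ j)) * (b (n ∸ j) + δ₁ (n ∸ j))                      ∎
      where
      vanish : ∀ {k} → suc (n ∸ j) ≤ k → ⟦ (n ∸ j) C k ⟧ * b k ≈ 0#
      vanish n∸j<k = ⟦0⟧*x≈0 _ (k>n⇒nCk≡0 n∸j<k)

    bernoulliPoly-shifted :
      bernoulliPoly b n h (w + h) ≈ ∑ℕ (suc n) (λ j → ⟦ n C j ⟧ * (w ^ j * h ^ (n ∸ j)) * (b (n ∸ j) + δ₁ (n ∸ j)))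
    bernoulliPoly-shifted = begin
      bernoulliPoly b n h (w + h)
        ≈⟨ bernoulliPoly-reversed b n h (w + h) ⟩
      ∑ℕ (suc n) (λ k → ⟦ n C k ⟧ * b k * h ^ k * (w + h) ^ (n ∸ k))
        ≈⟨ ∑ℕ-cong (λ {k} _ → binomial-expand k) ⟩
      ∑ℕ (suc n) (λ k → ∑ℕ (suc n) (T k))
        ≈⟨ ∑ℕ-cong (λ {k} _ → ∑ℕ-cong (λ {j} _ → binomial-swap k j)) ⟩
      ∑ℕ (suc n) (λ k → ∑ℕ (suc n) (λ j → S j k))
        ≈⟨ ∑ℕ-comm (suc n) (suc n) (λ k j → S j k) ⟩
      ∑ℕ (suc n) (λ j → ∑ℕ (suc n) (S j))
        ≈⟨ ∑ℕ-cong (λ {j} _ → bernoulli-inner-sum j) ⟩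
      ∑ℕ (suc n) (λ j → ⟦ n C j ⟧ * (w ^ j * h ^ (n ∸ j)) * (b (n ∸ j) + δ₁ (n ∸ j)))  ∎

  bernoulliPoly-shift : ∀ {b} → IsBernoulli b → ∀ m h w →
                        bernoulliPoly b (suc m) h (w + h) ≈ bernoulliPoly b (suc m) h w + ⟦ suc m ⟧ * (h * w ^ m)
  bernoulliPoly-shift {b} b-isBernoulli m h w = begin
    bernoulliPoly b n h (w + h)                                  ≈⟨ ShiftedExpansion.bernoulliPoly-shifted b-isBernoulli n h w ⟩
    ∑ℕ (suc n) (λ j → ⟦ n C j ⟧ * (w ^ j * h ^ (n ∸ j)) * (b (n ∸ j) + δ₁ (n ∸ j)))  ≈⟨ ∑ℕ-cong (λ {j} _ → split j) ⟩
    ∑ℕ (suc n) (λ j → ⟦ n C j ⟧ * b (n ∸ j) * h ^ (n ∸ j) * w ^ j + δ₁-term j)           ≈⟨ ∑ℕ-distrib-+ (suc n) _ δ₁-term ⟩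
    bernoulliPoly b n h w + ∑ℕ (suc n) δ₁-term                  ≈⟨ +-congˡ (δ₁-sum m h w) ⟩
    bernoulliPoly b n h w + ⟦ n ⟧ * (h * w ^ m)                  ∎
    where
    n = suc m
    δ₁-term : ℕ → Carrier
    δ₁-term j = ⟦ n C j ⟧ * (w ^ j * h ^ (n ∸ j)) * δ₁ (n ∸ j)
    split : ∀ j → ⟦ n C j ⟧ * (w ^ j * h ^ (n ∸ j)) * (b (n ∸ j) + δ₁ (n ∸ j))
                ≈ ⟦ n C j ⟧ * b (n ∸ j) * h ^ (n ∸ j) * w ^ j + δ₁-term j
    split j = solve 5 (λ a x y b′ d → a :* (x :* y) :* (b′ :+ d) := a :* b′ :* y :* x :+ a :* (x :* y) :* d) refl
                ⟦ n C j ⟧ (w ^ j) (h ^ (n ∸ j)) (b (n ∸ j)) (δ₁ (n ∸ j))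

ℚ-commutativeSemiring : CommutativeSemiring 0ℓ 0ℓ
ℚ-commutativeSemiring = CommutativeRing.commutativeSemiring ℚ.+-*-commutativeRing
  where import Data.Rational.Properties as ℚ

module BernoulliNumbers where

  open IntegersInRationals
  open Arithmetic using ([1+n]Cn≡1+n)
  open import Data.Integer as ℤ using (+_)
  open import Data.Rational as ℚ using (_/_; 0ℚ; 1ℚ)
  open import Data.Rational.Solver using (module +-*-Solver)
  open import Data.Nat.Combinatorics using (_C_; nCn≡1)
  open import Data.List using (_++_; [_]; zip; upTo)
  import Data.List.Properties as List
  open import Data.Product using (_,_; proj₁; proj₂)
  open ≡ using (_≡_; refl; cong; cong₂; sym; trans)
  open ≡.≡-Reasoning
  open RangeSum ℚ-commutativeSemiring
  open BernoulliPolynomial ℚ-commutativeSemiring using (⟦_⟧; IsBernoulli)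

  ⟦⟧≡fromℤ : ∀ n → ⟦ n ⟧ ≡ fromℤ (+ n)
  ⟦⟧≡fromℤ zero = refl
  ⟦⟧≡fromℤ (suc n) = trans (cong (1ℚ ℚ.+_) (⟦⟧≡fromℤ n)) (sym (fromℤ-homo-+ (+ 1) (+ n)))

  ⟦1+d⟧*1/[1+d]≡1 : ∀ d → ⟦ suc d ⟧ ℚ.* (+ 1 / suc d) ≡ 1ℚ
  ⟦1+d⟧*1/[1+d]≡1 d = begin
    ⟦ suc d ⟧ ℚ.* (+ 1 / suc d)          ≡⟨ cong (ℚ._* (+ 1 / suc d)) (⟦⟧≡fromℤ (suc d)) ⟩
    fromℤ (+ suc d) ℚ.* (+ 1 / suc d)    ≡⟨ /-≡-fromℤ-* (+ suc d) d ⟨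
    + suc d / suc d                      ≡⟨ [1+d]/[1+d]≡1 d ⟩
    1ℚ                                   ∎

  private
    lastOr-∷ʳ : ∀ d xs x → lastOr d (xs ++ [ x ]) ≡ x
    lastOr-∷ʳ d [] x = refl
    lastOr-∷ʳ d (y ∷ xs) x = lastOr-∷ʳ y xs x

    zip-applyUpTo : ∀ {a b} {A : Set a} {B′ : Set b} (f : ℕ → A) (g : A → B′) n →
                    zip (applyUpTo f n) (map g (applyUpTo f n)) ≡ applyUpTo (λ i → f i , g (f i)) n
    zip-applyUpTo f g zero = refl
    zip-applyUpTo f g (suc n) = cong ((f 0 , g (f 0)) ∷_) (zip-applyUpTo (f ∘ suc) g n)

  bernoulliList≡map-B : ∀ m → bernoulliList m ≡ map B (upTo (suc m))
  bernoulliList≡map-B zero = refl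
  bernoulliList≡map-B (suc m) = begin
    bernoulliList m ++ [ _ ]
      ≡⟨ cong₂ _++_ (bernoulliList≡map-B m) (cong [_] (sym (lastOr-∷ʳ 0ℚ (bernoulliList m) _))) ⟩
    map B (upTo (suc m)) ++ [ B (suc m) ]
      ≡⟨ List.map-++ B (upTo (suc m)) [ suc m ] ⟨
    map B (upTo (suc m) ++ [ suc m ])
      ≡⟨ cong (map B) (List.upTo-∷ʳ (suc m)) ⟩
    map B (upTo (suc (suc m)))               ∎

  B-suc : ∀ m → B (suc m) ≡ ℚ.- ((+ 1 / suc (suc m)) ℚ.* ∑ℕ (suc m) (λ k → ⟦ suc (suc m) C k ⟧ ℚ.* B k))
  B-suc m = begin
    B (suc m)
      ≡⟨ lastOr-∷ʳ 0ℚ (bernoulliList m) _ ⟩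
    ℚ.- ((+ 1 / N) ℚ.* sumℚ (map term (zip (upTo (suc m)) (bernoulliList m))))
      ≡⟨ cong (λ bs → ℚ.- ((+ 1 / N) ℚ.* sumℚ (map term (zip (upTo (suc m)) bs)))) (bernoulliList≡map-B m) ⟩
    ℚ.- ((+ 1 / N) ℚ.* sumℚ (map term (zip (upTo (suc m)) (map B (upTo (suc m))))))
      ≡⟨ cong (λ ps → ℚ.- ((+ 1 / N) ℚ.* sumℚ (map term ps))) (zip-applyUpTo (λ k → k) B (suc m)) ⟩
    ℚ.- ((+ 1 / N) ℚ.* sumℚ (map term (applyUpTo (λ k → k , B k) (suc m))))
      ≡⟨ cong (λ s → ℚ.- ((+ 1 / N) ℚ.* s)) (∑ℕ-applyUpTo term (λ k → k , B k) (suc m)) ⟩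
    ℚ.- ((+ 1 / N) ℚ.* ∑ℕ (suc m) (λ k → fromℤ (+ (N C k)) ℚ.* B k))
      ≡⟨ cong (λ s → ℚ.- ((+ 1 / N) ℚ.* s)) (∑ℕ-cong (λ {k} _ → cong (ℚ._* B k) (sym (⟦⟧≡fromℤ (N C k))))) ⟩
    ℚ.- ((+ 1 / N) ℚ.* ∑ℕ (suc m) (λ k → ⟦ N C k ⟧ ℚ.* B k))                          ∎
    where
    N = suc (suc m)
    term = λ p → (+ (N C proj₁ p) / 1) ℚ.* proj₂ p

  private
    bernoulli-vanishing-sum : ∀ m → ∑ℕ (suc (suc m)) (λ k → ⟦ suc (suc m) C k ⟧ ℚ.* B k) ≡ 0ℚ
    bernoulli-vanishing-sum m = begin
      ∑ℕ (suc (suc m)) f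
        ≡⟨ ∑ℕ-suc (suc m) f ⟩
      S ℚ.+ ⟦ N C suc m ⟧ ℚ.* B (suc m)
        ≡⟨ cong₂ (λ c b → S ℚ.+ ⟦ c ⟧ ℚ.* b) ([1+n]Cn≡1+n (suc m)) (B-suc m) ⟩
      S ℚ.+ ⟦ N ⟧ ℚ.* ℚ.- ((+ 1 / N) ℚ.* S)
        ≡⟨ solve 3 (λ s n i → s :+ n :* (:- (i :* s)) := s :* (con 1ℚ :- n :* i)) refl S ⟦ N ⟧ (+ 1 / N) ⟩
      S ℚ.* (1ℚ ℚ.- ⟦ N ⟧ ℚ.* (+ 1 / N))
        ≡⟨ cong (λ x → S ℚ.* (1ℚ ℚ.- x)) (⟦1+d⟧*1/[1+d]≡1 (suc m)) ⟩
      S ℚ.* (1ℚ ℚ.- 1ℚ)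
        ≡⟨ solve 1 (λ s → s :* (con 1ℚ :- con 1ℚ) := con 0ℚ) refl S ⟩
      0ℚ                                                  ∎
      where
      open +-*-Solver using (solve; _:=_; _:+_; _:*_; _:-_; :-_; con)
      N = suc (suc m)
      f = λ k → ⟦ N C k ⟧ ℚ.* B k
      S = ∑ℕ (suc m) f

  B-isBernoulli : IsBernoulli B
  B-isBernoulli zero = trans (∑ℕ-suc-head 0 _) (cong (1ℚ ℚ.+_) (∑ℕ-0 _))
  B-isBernoulli (suc zero) = trans (∑ℕ-suc-head 1 _) (cong (1ℚ ℚ.+_) (trans (∑ℕ-suc-head 0 _) (cong (B 1 ℚ.+_) (∑ℕ-0 _))))
  B-isBernoulli (suc (suc m)) = begin
    ∑ℕ (suc N) f              ≡⟨ ∑ℕ-suc N f ⟩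
    ∑ℕ N f ℚ.+ f N            ≡⟨ cong₂ (λ s c → s ℚ.+ ⟦ c ⟧ ℚ.* B N) (bernoulli-vanishing-sum m) (nCn≡1 N) ⟩
    0ℚ ℚ.+ 1ℚ ℚ.* B N         ≡⟨ solve 1 (λ b → con 0ℚ :+ con 1ℚ :* b := b :+ con 0ℚ) refl (B N) ⟩
    B N ℚ.+ 0ℚ                ∎
    where
    open +-*-Solver using (solve; _:=_; _:+_; _:*_; con)
    N = suc (suc m)
    f = λ k → ⟦ N C k ⟧ ℚ.* B k

module GaussianRationals where
  open import Data.Rational as ℚ using (ℚ; 0ℚ; 1ℚ)
  import Data.Rational.Properties as ℚ
  open import Data.Rational.Solver using (module +-*-Solver)
  open import Data.Product using (_,_)
  open import Algebra.Structures using (IsCommutativeRing)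
  open import Relation.Nullary.Decidable using (map′; _×-dec_)
  open import Relation.Binary.Definitions using (DecidableEquality)
  open import Relation.Binary.PropositionalEquality
  import Algebra.Solver.Ring.Simple
  import Algebra.Solver.Ring.AlmostCommutativeRing as ACR
  open IntegersInRationals
  open import Data.Integer as ℤ using (ℤ; +_)
  import Data.Integer.Properties as ℤ

  infix 5 _+i_

  record ℚ[i] : Set where
    constructor _+i_
    field
      re im : ℚ

  open ℚ[i] public

  module ℚ[i]-Operations where

    infixl 6 _+_ _-_
    infixl 7 _*_
    infix 8 -_

    _+_ : ℚ[i] → ℚ[i] → ℚ[i]
    (a +i b) + (c +i d) = (a ℚ.+ c) +i (b ℚ.+ d)

    _*_ : ℚ[i] → ℚ[i] → ℚ[i]
    (a +i b) * (c +i d) = (a ℚ.* c ℚ.- b ℚ.* d) +i (a ℚ.* d ℚ.+ b ℚ.* c)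

    -_ : ℚ[i] → ℚ[i]
    - (a +i b) = ℚ.- a +i ℚ.- b

    _-_ : ℚ[i] → ℚ[i] → ℚ[i]
    z - w = z + - w

    0# 1# : ℚ[i]
    0# = 0ℚ +i 0ℚ
    1# = 1ℚ +i 0ℚ

  open ℚ[i]-Operations

  private
    +i-cong : ∀ {a b c d} → a ≡ c → b ≡ d → a +i b ≡ c +i d
    +i-cong = cong₂ _+i_

  ℚ[i]-isCommutativeRing : IsCommutativeRing _≡_ _+_ _*_ -_ 0# 1#
  ℚ[i]-isCommutativeRing = record
    { isRing = record
      { +-isAbelianGroup = record
        { isGroup = record
          { isMonoid = record
            { isSemigroup = record
              { isMagma = record { isEquivalence = isEquivalence ; ∙-cong = cong₂ _+_ }
              ; assoc = λ { (a +i b) (c +i d) (e +i f) → +i-cong (ℚ.+-assoc a c e) (ℚ.+-assoc b d f) }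
              }
            ; identity = (λ { (a +i b) → +i-cong (ℚ.+-identityˡ a) (ℚ.+-identityˡ b) })
                       , (λ { (a +i b) → +i-cong (ℚ.+-identityʳ a) (ℚ.+-identityʳ b) })
            }
          ; inverse = (λ { (a +i b) → +i-cong (ℚ.+-inverseˡ a) (ℚ.+-inverseˡ b) })
                    , (λ { (a +i b) → +i-cong (ℚ.+-inverseʳ a) (ℚ.+-inverseʳ b) })
          ; ⁻¹-cong = cong (λ z → - z)
          }
        ; comm = λ { (a +i b) (c +i d) → +i-cong (ℚ.+-comm a c) (ℚ.+-comm b d) }
        }
      ; *-cong = cong₂ _*_
      ; *-assoc = λ { (a +i b) (c +i d) (e +i f) → +i-cong
          (solve 6 (λ a b c d e f → (a :* c :- b :* d) :* e :- (a :* d :+ b :* c) :* f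
                                  := a :* (c :* e :- d :* f) :- b :* (c :* f :+ d :* e)) refl a b c d e f)
          (solve 6 (λ a b c d e f → (a :* c :- b :* d) :* f :+ (a :* d :+ b :* c) :* e
                                  := a :* (c :* f :+ d :* e) :+ b :* (c :* e :- d :* f)) refl a b c d e f) }
      ; *-identity = (λ { (a +i b) → +i-cong (solve 2 (λ a b → con 1ℚ :* a :- con 0ℚ :* b := a) refl a b)
                                              (solve 2 (λ a b → con 1ℚ :* b :+ con 0ℚ :* a := b) refl a b) })
                   , (λ { (a +i b) → +i-cong (solve 2 (λ a b → a :* con 1ℚ :- b :* con 0ℚ := a) refl a b)
                                              (solve 2 (λ a b → a :* con 0ℚ :+ b :* con 1ℚ := b) refl a b) })
      ; distrib = (λ { (a +i b) (c +i d) (e +i f) → +i-cong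
                    (solve 6 (λ a b c d e f → a :* (c :+ e) :- b :* (d :+ f) := (a :* c :- b :* d) :+ (a :* e :- b :* f)) refl a b c d e f)
                    (solve 6 (λ a b c d e f → a :* (d :+ f) :+ b :* (c :+ e) := (a :* d :+ b :* c) :+ (a :* f :+ b :* e)) refl a b c d e f) })
                , (λ { (a +i b) (c +i d) (e +i f) → +i-cong
                    (solve 6 (λ a b c d e f → (c :+ e) :* a :- (d :+ f) :* b := (c :* a :- d :* b) :+ (e :* a :- f :* b)) refl a b c d e f)
                    (solve 6 (λ a b c d e f → (c :+ e) :* b :+ (d :+ f) :* a := (c :* b :+ d :* a) :+ (e :* b :+ f :* a)) refl a b c d e f) })
      }
    ; *-comm = λ { (a +i b) (c +i d) → +i-cong
        (solve 4 (λ a b c d → a :* c :- b :* d := c :* a :- d :* b) refl a b c d)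
        (solve 4 (λ a b c d → a :* d :+ b :* c := c :* b :+ d :* a) refl a b c d) }
    }
    where open +-*-Solver

  ℚ[i]-commutativeRing : CommutativeRing 0ℓ 0ℓ
  ℚ[i]-commutativeRing = record { isCommutativeRing = ℚ[i]-isCommutativeRing }

  _≟_ : DecidableEquality ℚ[i]
  (a +i b) ≟ (c +i d) = map′ (λ { (refl , refl) → refl }) (λ { refl → refl , refl }) ((a ℚ.≟ c) ×-dec (b ℚ.≟ d))

  module ℚ[i]-Solver =
    Algebra.Solver.Ring.Simple (ACR.fromCommutativeRing ℚ[i]-commutativeRing) _≟_

  ι : ℚ → ℚ[i]
  ι q = q +i 0ℚ

  conj : ℚ[i] → ℚ[i]
  conj (a +i b) = a +i ℚ.- b

  ι-homo-+ : ∀ p q → ι (p ℚ.+ q) ≡ ι p + ι q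
  ι-homo-+ p q = refl

  ι-homo-* : ∀ p q → ι (p ℚ.* q) ≡ ι p * ι q
  ι-homo-* p q = +i-cong (solve 2 (λ p q → p :* q := p :* q :- con 0ℚ :* con 0ℚ) refl p q)
                         (solve 2 (λ p q → con 0ℚ := p :* con 0ℚ :+ con 0ℚ :* q) refl p q)
    where open +-*-Solver

  im-ι* : ∀ q w → im (ι q * w) ≡ q ℚ.* im w
  im-ι* q (a +i b) = solve 3 (λ q a b → q :* b :+ con 0ℚ :* a := q :* b) refl q a b
    where open +-*-Solver

  im-*ι : ∀ w q → im (w * ι q) ≡ im w ℚ.* q
  im-*ι (a +i b) q = solve 3 (λ q a b → a :* con 0ℚ :+ b :* q := b :* q) refl q a b
    where open +-*-Solver

  conj-homo-* : ∀ z w → conj (z * w) ≡ conj z * conj w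
  conj-homo-* (a +i b) (c +i d) = +i-cong (solve 4 (λ a b c d → a :* c :- b :* d := a :* c :- (:- b) :* (:- d)) refl a b c d)
                                          (solve 4 (λ a b c d → :- (a :* d :+ b :* c) := a :* (:- d) :+ (:- b) :* c) refl a b c d)
    where open +-*-Solver

  im-‿conj : ∀ z → im (- conj z) ≡ im z
  im-‿conj (a +i b) = solve 1 (λ b → :- (:- b) := b) refl b
    where open +-*-Solver

  open import Algebra.Properties.Semiring.Exp (CommutativeRing.semiring ℚ[i]-commutativeRing) using (_^_)

  ιℤ : ℤ → ℚ[i]
  ιℤ i = ι (fromℤ i)

  ιℤ-homo-+ : ∀ a b → ιℤ (a ℤ.+ b) ≡ ιℤ a + ιℤ b
  ιℤ-homo-+ a b = cong ι (fromℤ-homo-+ a b)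

  ιℤ-homo-* : ∀ a b → ιℤ (a ℤ.* b) ≡ ιℤ a * ιℤ b
  ιℤ-homo-* a b = trans (cong ι (fromℤ-homo-* a b)) (ι-homo-* (fromℤ a) (fromℤ b))

  ιℤ-homo‿- : ∀ a → ιℤ (ℤ.- a) ≡ - ιℤ a
  ιℤ-homo‿- a = cong ι (fromℤ-homo‿- a)

  module _ {w : ℚ[i]} {b c : ℤ} (w²≡bw-c : w * w ≡ ιℤ b * w - ιℤ c) where
    open ≡-Reasoning

    ^-lucas : ∀ m → w ^ suc m ≡ ιℤ (U b c (suc m)) * w - ιℤ (c ℤ.* U b c m)
    ^-lucas zero = begin
      w * 1#                          ≡⟨ solve 1 (λ w → w :* con 1# := con 1# :* w :- con 0#) refl w ⟩
      1# * w - 0#                     ≡⟨ cong (λ x → 1# * w - ιℤ x) (ℤ.*-zeroʳ c) ⟨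
      ιℤ (+ 1) * w - ιℤ (c ℤ.* + 0)   ∎
      where open ℚ[i]-Solver
    ^-lucas (suc m) = begin
      w * w ^ suc m
        ≡⟨ cong (w *_) (^-lucas m) ⟩
      w * (ιℤ u₁ * w - ιℤ (c ℤ.* u₀))
        ≡⟨ solve 4 (λ w x y z → w :* (x :* w :- y) := x :* (w :* w) :- y :* w) refl w (ιℤ u₁) (ιℤ (c ℤ.* u₀)) (ιℤ c) ⟩
      ιℤ u₁ * (w * w) - ιℤ (c ℤ.* u₀) * w
        ≡⟨ cong (λ x → ιℤ u₁ * x - ιℤ (c ℤ.* u₀) * w) w²≡bw-c ⟩
      ιℤ u₁ * (ιℤ b * w - ιℤ c) - ιℤ (c ℤ.* u₀) * w
        ≡⟨ solve 5 (λ w x y z b′ → x :* (b′ :* w :- z) :- y :* w := (b′ :* x :- y) :* w :- z :* x) refl w (ιℤ u₁) (ιℤ (c ℤ.* u₀)) (ιℤ c) (ιℤ b) ⟩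
      (ιℤ b * ιℤ u₁ - ιℤ (c ℤ.* u₀)) * w - ιℤ c * ιℤ u₁
        ≡⟨ cong₂ (λ x y → x * w - y) eq (sym (ιℤ-homo-* c u₁)) ⟩
      ιℤ (U b c (suc (suc m))) * w - ιℤ (c ℤ.* u₁)      ∎
      where
      open ℚ[i]-Solver
      u₀ = U b c m
      u₁ = U b c (suc m)
      eq : ιℤ b * ιℤ u₁ - ιℤ (c ℤ.* u₀) ≡ ιℤ (b ℤ.* u₁ ℤ.- c ℤ.* u₀)
      eq = sym (trans (ιℤ-homo-+ (b ℤ.* u₁) (ℤ.- (c ℤ.* u₀)))
                      (cong₂ _+_ (ιℤ-homo-* b u₁) (ιℤ-homo‿- (c ℤ.* u₀))))

    im-^-lucas : ∀ m → im (w ^ m) ≡ fromℤ (U b c m) ℚ.* im w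
    im-^-lucas zero = sym (ℚ.*-zeroˡ (im w))
    im-^-lucas (suc m) = begin
      im (w ^ suc m)
        ≡⟨ cong im (^-lucas m) ⟩
      im (ιℤ (U b c (suc m)) * w) ℚ.+ ℚ.- 0ℚ
        ≡⟨ cong (ℚ._+ ℚ.- 0ℚ) (im-ι* (fromℤ (U b c (suc m))) w) ⟩
      fromℤ (U b c (suc m)) ℚ.* im w ℚ.+ ℚ.- 0ℚ
        ≡⟨ solve 1 (λ x → x :+ :- con 0ℚ := x) refl (fromℤ (U b c (suc m)) ℚ.* im w) ⟩
      fromℤ (U b c (suc m)) ℚ.* im w                      ∎
      where open +-*-Solver

module GaussianEvaluation where
  open IntegersInRationals
  open Arithmetic
  open GaussianRationals
  open import Data.Nat.Combinatorics using (_C_)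
  open import Data.Integer as ℤ using (ℤ; +_)
  import Data.Integer.Properties as ℤ
  open import Data.Rational as ℚ using (ℚ; 0ℚ)
  import Data.Rational.Properties as ℚ
  open import Data.Rational.Solver using () renaming (module +-*-Solver to ℚ-Solver)
  open import Data.Integer.Solver using () renaming (module +-*-Solver to ℤ-Solver)
  open import Data.Bool using (true; false; if_then_else_)
  open import Relation.Binary.PropositionalEquality
  open ≡-Reasoning

  ℚ[i]-commutativeSemiring : CommutativeSemiring 0ℓ 0ℓ
  ℚ[i]-commutativeSemiring = CommutativeRing.commutativeSemiring ℚ[i]-commutativeRing

  open ℚ[i]-Operations
  open RangeSum ℚ[i]-commutativeSemiring
  open BernoulliPolynomial ℚ[i]-commutativeSemiring
  open import Algebra.Properties.Semiring.Exp (CommutativeRing.semiring ℚ[i]-commutativeRing) using (_^_; ^-homo-*)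
  open import Data.Nat.DivMod using (_%_; m*n/n≡m; +-distrib-/-∣ʳ; [m+kn]%n≡m%n; m<n⇒m%n≡m)
  open import Data.Nat.Divisibility using (divides-refl)
  open import Data.Nat.Solver using () renaming (module +-*-Solver to ℕ-Solver)
  open RangeSumHomomorphism ℚ-commutativeSemiring ℚ[i]-commutativeSemiring using () renaming (∑ℕ-homo to ∑ℕ-homo-ι)
  open RangeSumHomomorphism ℚ[i]-commutativeSemiring ℚ-commutativeSemiring using () renaming (∑ℕ-homo to ∑ℕ-homo-im)

  module ℚ′ where
    open RangeSum ℚ-commutativeSemiring public using (∑ℕ; ∑ℕ-cong; ∑ℕ-distrib-+; *-distribˡ-∑ℕ; ∑ℕ-applyUpTo)
    open BernoulliPolynomial ℚ-commutativeSemiring public using (⟦_⟧; δ₁)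
    open import Algebra.Properties.Semiring.Exp (CommutativeSemiring.semiring ℚ-commutativeSemiring) public using (_^_)

  ι-⟦⟧ : ∀ n → ι ℚ′.⟦ n ⟧ ≡ ⟦ n ⟧
  ι-⟦⟧ zero = refl
  ι-⟦⟧ (suc n) = cong (λ z → 1# + z) (ι-⟦⟧ n)

  ι-δ₁ : ∀ n → ι (ℚ′.δ₁ n) ≡ δ₁ n
  ι-δ₁ zero = refl
  ι-δ₁ (suc zero) = refl
  ι-δ₁ (suc (suc n)) = refl

  ι-^ : ∀ q n → ι (q ℚ′.^ n) ≡ ι q ^ n
  ι-^ q zero = refl
  ι-^ q (suc n) = trans (ι-homo-* q (q ℚ′.^ n)) (cong (ι q *_) (ι-^ q n))

  ι-∑ℕ : ∀ n f → ι (ℚ′.∑ℕ n f) ≡ ∑ℕ n (ι ∘ f)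
  ι-∑ℕ = ∑ℕ-homo-ι ι refl ι-homo-+

  im-∑ℕ : ∀ n f → im (∑ℕ n f) ≡ ℚ′.∑ℕ n (im ∘ f)
  im-∑ℕ = ∑ℕ-homo-im im refl (λ _ _ → refl)

  ιB-isBernoulli : IsBernoulli (ι ∘ B)
  ιB-isBernoulli m = begin
    ∑ℕ (suc m) (λ k → ⟦ m C k ⟧ * ι (B k))
      ≡⟨ ∑ℕ-cong (λ {k} _ → trans (cong (_* ι (B k)) (sym (ι-⟦⟧ (m C k)))) (sym (ι-homo-* ℚ′.⟦ m C k ⟧ (B k)))) ⟩
    ∑ℕ (suc m) (ι ∘ (λ k → ℚ′.⟦ m C k ⟧ ℚ.* B k))
      ≡⟨ ι-∑ℕ (suc m) _ ⟨
    ι (ℚ′.∑ℕ (suc m) (λ k → ℚ′.⟦ m C k ⟧ ℚ.* B k))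
      ≡⟨ cong ι (BernoulliNumbers.B-isBernoulli m) ⟩
    ι (B m) + ι (ℚ′.δ₁ m)
      ≡⟨ cong (λ z → ι (B m) + z) (ι-δ₁ m) ⟩
    ι (B m) + δ₁ m                                  ∎

  coefficient : ℕ → ℕ → ℚ
  coefficient n j = ℚ′.⟦ n C j ⟧ ℚ.* B (n ∸ j) ℚ.* ℚ′.⟦ 2 ⟧ ℚ′.^ (n ∸ j)

  im-bernoulliPoly : ∀ n w → im (bernoulliPoly (ι ∘ B) n ⟦ 2 ⟧ w) ≡ ℚ′.∑ℕ (suc n) (λ j → coefficient n j ℚ.* im (w ^ j))
  im-bernoulliPoly n w = trans (im-∑ℕ (suc n) _) (ℚ′.∑ℕ-cong (λ {j} _ → trans (cong (λ z → im (z * w ^ j)) (coefficient-ι j)) (im-ι* (coefficient n j) (w ^ j))))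
    where
    coefficient-ι : ∀ j → ⟦ n C j ⟧ * ι (B (n ∸ j)) * ⟦ 2 ⟧ ^ (n ∸ j) ≡ ι (coefficient n j)
    coefficient-ι j = sym (begin
      ι (ℚ′.⟦ n C j ⟧ ℚ.* B (n ∸ j) ℚ.* ℚ′.⟦ 2 ⟧ ℚ′.^ (n ∸ j))
        ≡⟨ ι-homo-* (ℚ′.⟦ n C j ⟧ ℚ.* B (n ∸ j)) _ ⟩
      ι (ℚ′.⟦ n C j ⟧ ℚ.* B (n ∸ j)) * ι (ℚ′.⟦ 2 ⟧ ℚ′.^ (n ∸ j))
        ≡⟨ cong₂ _*_ (ι-homo-* ℚ′.⟦ n C j ⟧ (B (n ∸ j))) (ι-^ ℚ′.⟦ 2 ⟧ (n ∸ j)) ⟩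
      ι ℚ′.⟦ n C j ⟧ * ι (B (n ∸ j)) * ι ℚ′.⟦ 2 ⟧ ^ (n ∸ j)
        ≡⟨ cong₂ (λ x y → x * ι (B (n ∸ j)) * y ^ (n ∸ j)) (ι-⟦⟧ (n C j)) (ι-⟦⟧ 2) ⟩
      ⟦ n C j ⟧ * ι (B (n ∸ j)) * ⟦ 2 ⟧ ^ (n ∸ j)                    ∎)

  im-⟦⟧*⟦2⟧* : ∀ n v → im (⟦ n ⟧ * (⟦ 2 ⟧ * v)) ≡ ℚ′.⟦ n ⟧ ℚ.* (ℚ′.⟦ 2 ⟧ ℚ.* im v)
  im-⟦⟧*⟦2⟧* n v = begin
    im (⟦ n ⟧ * (⟦ 2 ⟧ * v))                 ≡⟨ cong₂ (λ x y → im (x * (y * v))) (ι-⟦⟧ n) (ι-⟦⟧ 2) ⟨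
    im (ι ℚ′.⟦ n ⟧ * (ι ℚ′.⟦ 2 ⟧ * v))       ≡⟨ im-ι* ℚ′.⟦ n ⟧ (ι ℚ′.⟦ 2 ⟧ * v) ⟩
    ℚ′.⟦ n ⟧ ℚ.* im (ι ℚ′.⟦ 2 ⟧ * v)         ≡⟨ cong (ℚ′.⟦ n ⟧ ℚ.*_) (im-ι* ℚ′.⟦ 2 ⟧ v) ⟩
    ℚ′.⟦ n ⟧ ℚ.* (ℚ′.⟦ 2 ⟧ ℚ.* im v)         ∎

  X Y W₁ W₂ : ℚ[i]
  X  = fromℤ (+ 3) +i fromℤ (+ 3)
  Y  = fromℤ (ℤ.- + 3) +i fromℤ (+ 3)
  W₁ = fromℤ (ℤ.- + 1) +i fromℤ (+ 3)
  W₂ = fromℤ (+ 1) +i fromℤ (+ 3)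

  X⁴≡-324 : X ^ 4 ≡ ιℤ (ℤ.- + 324)
  X⁴≡-324 = refl

  Y⁴≡-324 : Y ^ 4 ≡ ιℤ (ℤ.- + 324)
  Y⁴≡-324 = refl

  module _ {w : ℚ[i]} {c : ℤ} (w⁴≡c : w ^ 4 ≡ ιℤ c) where

    ^-*4 : ∀ q → w ^ (q ℕ.* 4) ≡ ιℤ (c ℤ.^ q)
    ^-*4 zero = refl
    ^-*4 (suc q) = begin
      w ^ (4 ℕ.+ q ℕ.* 4)         ≡⟨ ^-homo-* w 4 (q ℕ.* 4) ⟩
      w ^ 4 * w ^ (q ℕ.* 4)       ≡⟨ cong₂ _*_ w⁴≡c (^-*4 q) ⟩
      ιℤ c * ιℤ (c ℤ.^ q)         ≡⟨ ιℤ-homo-* c (c ℤ.^ q) ⟨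
      ιℤ (c ℤ.^ suc q)            ∎

    im-^-r+4q : ∀ r q → im (w ^ (r ℕ.+ q ℕ.* 4)) ≡ im (w ^ r) ℚ.* fromℤ (c ℤ.^ q)
    im-^-r+4q r q = begin
      im (w ^ (r ℕ.+ q ℕ.* 4))          ≡⟨ cong im (^-homo-* w r (q ℕ.* 4)) ⟩
      im (w ^ r * w ^ (q ℕ.* 4))        ≡⟨ cong (λ z → im (w ^ r * z)) (^-*4 q) ⟩
      im (w ^ r * ιℤ (c ℤ.^ q))         ≡⟨ im-*ι (w ^ r) (fromℤ (c ℤ.^ q)) ⟩
      im (w ^ r) ℚ.* fromℤ (c ℤ.^ q)    ∎

  [-conj]^odd : ∀ z p → (- conj z) ^ suc (p ℕ.* 2) ≡ - conj (z ^ suc (p ℕ.* 2))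
  [-conj]^odd z zero = begin
    - conj z * 1#             ≡⟨ solve 1 (λ x → (:- x) :* con 1# := :- (x :* con 1#)) refl (conj z) ⟩
    - (conj z * conj 1#)      ≡⟨ cong -_ (conj-homo-* z 1#) ⟨
    - conj (z * 1#)           ∎
    where open ℚ[i]-Solver
  [-conj]^odd z (suc p) = begin
    - conj z * (- conj z * (- conj z) ^ suc (p ℕ.* 2))
      ≡⟨ cong (λ x → - conj z * (- conj z * x)) ([-conj]^odd z p) ⟩
    - conj z * (- conj z * - conj zᵐ)
      ≡⟨ solve 2 (λ x y → (:- x) :* ((:- x) :* (:- y)) := :- (x :* (x :* y))) refl (conj z) (conj zᵐ) ⟩
    - (conj z * (conj z * conj zᵐ))
      ≡⟨ cong (λ x → - (conj z * x)) (conj-homo-* z zᵐ) ⟨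
    - (conj z * conj (z * zᵐ))
      ≡⟨ cong -_ (conj-homo-* z (z * zᵐ)) ⟨
    - conj (z * (z * zᵐ))                                 ∎
    where
    open ℚ[i]-Solver
    zᵐ = z ^ suc (p ℕ.* 2)

  private
    ⟦2⟧*im-Y^[r+4t] : ∀ r t c → im (Y ^ r) ≡ fromℤ (+ c) →
      ℚ′.⟦ 2 ⟧ ℚ.* im (Y ^ (r ℕ.+ t ℕ.* 4)) ≡ fromℤ (sgn t ℤ.* + (2 ℕ.* c ℕ.* 324 ℕ.^ t))
    ⟦2⟧*im-Y^[r+4t] r t c im-Yʳ = begin
      ℚ′.⟦ 2 ⟧ ℚ.* im (Y ^ (r ℕ.+ t ℕ.* 4))
        ≡⟨ cong₂ ℚ._*_ (BernoulliNumbers.⟦⟧≡fromℤ 2) (im-^-r+4q {Y} {ℤ.- + 324} Y⁴≡-324 r t) ⟩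
      fromℤ (+ 2) ℚ.* (im (Y ^ r) ℚ.* fromℤ ((ℤ.- + 324) ℤ.^ t))
        ≡⟨ cong (λ x → fromℤ (+ 2) ℚ.* (x ℚ.* fromℤ ((ℤ.- + 324) ℤ.^ t))) im-Yʳ ⟩
      fromℤ (+ 2) ℚ.* (fromℤ (+ c) ℚ.* fromℤ ((ℤ.- + 324) ℤ.^ t))
        ≡⟨ cong (fromℤ (+ 2) ℚ.*_) (fromℤ-homo-* (+ c) ((ℤ.- + 324) ℤ.^ t)) ⟨
      fromℤ (+ 2) ℚ.* fromℤ (+ c ℤ.* (ℤ.- + 324) ℤ.^ t)
        ≡⟨ fromℤ-homo-* (+ 2) (+ c ℤ.* (ℤ.- + 324) ℤ.^ t) ⟨
      fromℤ (+ 2 ℤ.* (+ c ℤ.* (ℤ.- + 324) ℤ.^ t))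
        ≡⟨ cong fromℤ integral ⟩
      fromℤ (sgn t ℤ.* + (2 ℕ.* c ℕ.* 324 ℕ.^ t))                ∎
      where
      integral : + 2 ℤ.* (+ c ℤ.* (ℤ.- + 324) ℤ.^ t) ≡ sgn t ℤ.* + (2 ℕ.* c ℕ.* 324 ℕ.^ t)
      integral = begin
        + 2 ℤ.* (+ c ℤ.* (ℤ.- + 324) ℤ.^ t)
          ≡⟨ cong (λ x → + 2 ℤ.* (+ c ℤ.* x)) (-[a]^q≡sgn[q]*a^q 324 t) ⟩
        + 2 ℤ.* (+ c ℤ.* (sgn t ℤ.* + (324 ℕ.^ t)))
          ≡⟨ solve 4 (λ a b s x → a :* (b :* (s :* x)) := s :* (a :* b :* x)) refl (+ 2) (+ c) (sgn t) (+ (324 ℕ.^ t)) ⟩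
        sgn t ℤ.* (+ 2 ℤ.* + c ℤ.* + (324 ℕ.^ t))
          ≡⟨ cong (λ x → sgn t ℤ.* (x ℤ.* + (324 ℕ.^ t))) (ℤ.pos-* 2 c) ⟨
        sgn t ℤ.* (+ (2 ℕ.* c) ℤ.* + (324 ℕ.^ t))
          ≡⟨ cong (sgn t ℤ.*_) (ℤ.pos-* (2 ℕ.* c) (324 ℕ.^ t)) ⟨
        sgn t ℤ.* + (2 ℕ.* c ℕ.* 324 ℕ.^ t)                 ∎
        where open ℤ-Solver

  ⟦2⟧*im-Y^[1+2p] : ∀ p →
    ℚ′.⟦ 2 ⟧ ℚ.* im (Y ^ suc (p ℕ.* 2)) ≡ fromℤ (sgn (p ℕ.* 2 ℕ./ 4) ℤ.* + (2 ℕ.^ suc p ℕ.* 3 ℕ.^ suc (p ℕ.* 2)))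
  ⟦2⟧*im-Y^[1+2p] = divMod-elim P 2 P[r+2t]
    where
    P : ℕ → Set
    P p = ℚ′.⟦ 2 ⟧ ℚ.* im (Y ^ suc (p ℕ.* 2)) ≡ fromℤ (sgn (p ℕ.* 2 ℕ./ 4) ℤ.* + (2 ℕ.^ suc p ℕ.* 3 ℕ.^ suc (p ℕ.* 2)))
    open ℕ-Solver
    4t : ∀ t → t ℕ.* 2 ℕ.* 2 ≡ t ℕ.* 4
    4t = solve 1 (λ t → t :* con 2 :* con 2 := t :* con 4) refl
    P[r+2t] : ∀ r t → r ℕ.< 2 → P (r ℕ.+ t ℕ.* 2)
    P[r+2t] 0 t _ = begin
      ℚ′.⟦ 2 ⟧ ℚ.* im (Y ^ suc (t ℕ.* 2 ℕ.* 2))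
        ≡⟨ cong (λ k → ℚ′.⟦ 2 ⟧ ℚ.* im (Y ^ suc k)) (4t t) ⟩
      ℚ′.⟦ 2 ⟧ ℚ.* im (Y ^ (1 ℕ.+ t ℕ.* 4))
        ≡⟨ ⟦2⟧*im-Y^[r+4t] 1 t 3 refl ⟩
      fromℤ (sgn t ℤ.* + (2 ℕ.* 3 ℕ.* 324 ℕ.^ t))
        ≡⟨ cong₂ (λ a b → fromℤ (sgn a ℤ.* + b)) (sym (trans (cong (ℕ._/ 4) (4t t)) (m*n/n≡m t 4))) powers ⟩
      fromℤ (sgn (t ℕ.* 2 ℕ.* 2 ℕ./ 4) ℤ.* + (2 ℕ.^ suc (t ℕ.* 2) ℕ.* 3 ℕ.^ suc (t ℕ.* 2 ℕ.* 2)))  ∎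
      where
      powers : 2 ℕ.* 3 ℕ.* 324 ℕ.^ t ≡ 2 ℕ.^ suc (t ℕ.* 2) ℕ.* 3 ℕ.^ suc (t ℕ.* 2 ℕ.* 2)
      powers = begin
        2 ℕ.* 3 ℕ.* 324 ℕ.^ t
          ≡⟨ cong (2 ℕ.* 3 ℕ.*_) (324^q≡2^[2q]*3^[4q] t) ⟩
        2 ℕ.* 3 ℕ.* (2 ℕ.^ (t ℕ.* 2) ℕ.* 3 ℕ.^ (t ℕ.* 4))
          ≡⟨ solve 2 (λ a b → con 2 :* con 3 :* (a :* b) := con 2 :* a :* (con 3 :* b)) refl (2 ℕ.^ (t ℕ.* 2)) (3 ℕ.^ (t ℕ.* 4)) ⟩
        2 ℕ.^ suc (t ℕ.* 2) ℕ.* 3 ℕ.^ suc (t ℕ.* 4)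
          ≡⟨ cong (λ k → 2 ℕ.^ suc (t ℕ.* 2) ℕ.* 3 ℕ.^ suc k) (4t t) ⟨
        2 ℕ.^ suc (t ℕ.* 2) ℕ.* 3 ℕ.^ suc (t ℕ.* 2 ℕ.* 2)        ∎
    P[r+2t] 1 t _ = begin
      ℚ′.⟦ 2 ⟧ ℚ.* im (Y ^ (3 ℕ.+ t ℕ.* 2 ℕ.* 2))    ≡⟨ cong (λ k → ℚ′.⟦ 2 ⟧ ℚ.* im (Y ^ (3 ℕ.+ k))) (4t t) ⟩
      ℚ′.⟦ 2 ⟧ ℚ.* im (Y ^ (3 ℕ.+ t ℕ.* 4))          ≡⟨ ⟦2⟧*im-Y^[r+4t] 3 t 54 refl ⟩
      fromℤ (sgn t ℤ.* + (2 ℕ.* 54 ℕ.* 324 ℕ.^ t))   ≡⟨ cong₂ (λ a b → fromℤ (sgn a ℤ.* + b)) (sym quotient) powers ⟩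
      fromℤ (sgn ((2 ℕ.+ t ℕ.* 2 ℕ.* 2) ℕ./ 4) ℤ.* + (2 ℕ.^ (2 ℕ.+ t ℕ.* 2) ℕ.* 3 ℕ.^ (3 ℕ.+ t ℕ.* 2 ℕ.* 2)))  ∎
      where
      quotient : (2 ℕ.+ t ℕ.* 2 ℕ.* 2) ℕ./ 4 ≡ t
      quotient = trans (cong (λ k → (2 ℕ.+ k) ℕ./ 4) (4t t)) (trans (+-distrib-/-∣ʳ 2 {d = 4} (divides-refl t)) (m*n/n≡m t 4))
      powers : 2 ℕ.* 54 ℕ.* 324 ℕ.^ t ≡ 2 ℕ.^ (2 ℕ.+ t ℕ.* 2) ℕ.* 3 ℕ.^ (3 ℕ.+ t ℕ.* 2 ℕ.* 2)
      powers = begin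
        2 ℕ.* 54 ℕ.* 324 ℕ.^ t
          ≡⟨ cong (2 ℕ.* 54 ℕ.*_) (324^q≡2^[2q]*3^[4q] t) ⟩
        2 ℕ.* 54 ℕ.* (2 ℕ.^ (t ℕ.* 2) ℕ.* 3 ℕ.^ (t ℕ.* 4))
          ≡⟨ solve 2 (λ a b → con 2 :* con 54 :* (a :* b) := con 2 :* (con 2 :* a) :* (con 3 :* (con 3 :* (con 3 :* b)))) refl (2 ℕ.^ (t ℕ.* 2)) (3 ℕ.^ (t ℕ.* 4)) ⟩
        2 ℕ.^ (2 ℕ.+ t ℕ.* 2) ℕ.* 3 ℕ.^ (3 ℕ.+ t ℕ.* 4)
          ≡⟨ cong (λ k → 2 ℕ.^ (2 ℕ.+ t ℕ.* 2) ℕ.* 3 ℕ.^ (3 ℕ.+ k)) (4t t) ⟨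
        2 ℕ.^ (2 ℕ.+ t ℕ.* 2) ℕ.* 3 ℕ.^ (3 ℕ.+ t ℕ.* 2 ℕ.* 2)    ∎
    P[r+2t] (suc (suc _)) _ (ℕ.s≤s (ℕ.s≤s ()))

  signedPower : ℕ → ℕ → ℚ
  signedPower n k = fromℤ (sgn ((k ∸ 2) ℕ./ 4) ℤ.* + (2 ℕ.^ (n ∸ (k ℕ./ 2)) ℕ.* 3 ℕ.^ k))

  lhsWeight : ℕ → ℕ → ℚ
  lhsWeight n k = if k % 4 ℕ.≡ᵇ 2 then signedPower n k else 0ℚ

  lhsTerm≡⟦C⟧*lhsWeight*B : ∀ n k → lhsTerm n k ≡ ℚ′.⟦ n C k ⟧ ℚ.* lhsWeight n k ℚ.* B (n ∸ k)
  lhsTerm≡⟦C⟧*lhsWeight*B n k with k % 4 ℕ.≡ᵇ 2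
  ... | true  = cong (λ c → c ℚ.* signedPower n k ℚ.* B (n ∸ k)) (sym (BernoulliNumbers.⟦⟧≡fromℤ (n C k)))
  ... | false = solve 2 (λ c b → con 0ℚ := c :* con 0ℚ :* b) refl ℚ′.⟦ n C k ⟧ (B (n ∸ k))
    where open ℚ-Solver using (solve; _:=_; _:+_; _:*_; _:-_; :-_; con)

  ⟦2⟧^e≡fromℤ[2^e] : ∀ e → ℚ′.⟦ 2 ⟧ ℚ′.^ e ≡ fromℤ (+ (2 ℕ.^ e))
  ⟦2⟧^e≡fromℤ[2^e] zero = refl
  ⟦2⟧^e≡fromℤ[2^e] (suc e) = begin
    ℚ′.⟦ 2 ⟧ ℚ.* ℚ′.⟦ 2 ⟧ ℚ′.^ e        ≡⟨ cong (ℚ′.⟦ 2 ⟧ ℚ.*_) (⟦2⟧^e≡fromℤ[2^e] e) ⟩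
    fromℤ (+ 2) ℚ.* fromℤ (+ (2 ℕ.^ e))  ≡⟨ fromℤ-homo-* (+ 2) (+ (2 ℕ.^ e)) ⟨
    fromℤ (+ 2 ℤ.* + (2 ℕ.^ e))          ≡⟨ cong fromℤ (ℤ.pos-* 2 (2 ℕ.^ e)) ⟨
    fromℤ (+ (2 ℕ.^ suc e))              ∎

  private
    lhsWeight-mod : ∀ {n j r} → j % 4 ≡ r → lhsWeight n j ≡ (if r ℕ.≡ᵇ 2 then signedPower n j else 0ℚ)
    lhsWeight-mod {n} {j} = cong (λ r → if r ℕ.≡ᵇ 2 then signedPower n j else 0ℚ)

    [r+4q]%4≡r : ∀ r q → r ℕ.< 4 → (r ℕ.+ q ℕ.* 4) % 4 ≡ r
    [r+4q]%4≡r r q r<4 = trans ([m+kn]%n≡m%n r q 4) (m<n⇒m%n≡m r<4)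

    X-vs-Y-2mod4 : ∀ {n} q → 2 ℕ.+ q ℕ.* 4 ℕ.≤ n →
      let j = 2 ℕ.+ q ℕ.* 4 in
      ℚ′.⟦ 2 ⟧ ℚ′.^ (n ∸ j) ℚ.* im (X ^ j)
        ≡ ℚ′.⟦ 2 ⟧ ℚ′.^ (n ∸ j) ℚ.* im (Y ^ j) ℚ.+ ℚ′.⟦ 2 ⟧ ℚ.* signedPower n j
    X-vs-Y-2mod4 {n} q j≤n = begin
      E ℚ.* im (X ^ j)
        ≡⟨ cong₂ ℚ._*_ (⟦2⟧^e≡fromℤ[2^e] (n ∸ j)) (im-^-r+4q {X} {ℤ.- + 324} X⁴≡-324 2 q) ⟩
      F ℚ.* (fromℤ (+ 18) ℚ.* s)
        ≡⟨ solve 2 (λ f s → f :* (con (fromℤ (+ 18)) :* s) := f :* (con (fromℤ (ℤ.- + 18)) :* s) :+ con (fromℤ (+ 36)) :* f :* s) refl F s ⟩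
      F ℚ.* (fromℤ (ℤ.- + 18) ℚ.* s) ℚ.+ fromℤ (+ 36) ℚ.* F ℚ.* s
        ≡⟨ cong₂ ℚ._+_ (cong₂ ℚ._*_ (sym (⟦2⟧^e≡fromℤ[2^e] (n ∸ j))) (sym (im-^-r+4q {Y} {ℤ.- + 324} Y⁴≡-324 2 q))) weighted ⟩
      E ℚ.* im (Y ^ j) ℚ.+ ℚ′.⟦ 2 ⟧ ℚ.* fromℤ K
        ≡⟨ cong₂ (λ a b → E ℚ.* im (Y ^ j) ℚ.+ ℚ′.⟦ 2 ⟧ ℚ.* fromℤ (sgn a ℤ.* + (2 ℕ.^ (n ∸ b) ℕ.* 3 ℕ.^ j))) (sym (m*n/n≡m q 4)) (sym ([2+4q]/2≡1+2q q)) ⟩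
      E ℚ.* im (Y ^ j) ℚ.+ ℚ′.⟦ 2 ⟧ ℚ.* fromℤ (sgn ((j ∸ 2) ℕ./ 4) ℤ.* + (2 ℕ.^ (n ∸ (j ℕ./ 2)) ℕ.* 3 ℕ.^ j))  ∎
      where
      open ℚ-Solver using (solve; _:=_; _:+_; _:*_; _:-_; :-_; con)
      j = 2 ℕ.+ q ℕ.* 4
      e = n ∸ j
      E = ℚ′.⟦ 2 ⟧ ℚ′.^ e
      F = fromℤ (+ (2 ℕ.^ e))
      s = fromℤ ((ℤ.- + 324) ℤ.^ q)
      M = 2 ℕ.^ (n ∸ (1 ℕ.+ q ℕ.* 2)) ℕ.* 3 ℕ.^ j
      K = sgn q ℤ.* + M
      weighted : fromℤ (+ 36) ℚ.* F ℚ.* s ≡ ℚ′.⟦ 2 ⟧ ℚ.* fromℤ K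
      weighted = begin
        fromℤ (+ 36) ℚ.* F ℚ.* s                               ≡⟨ cong (ℚ._* s) (fromℤ-homo-* (+ 36) (+ (2 ℕ.^ e))) ⟨
        fromℤ (+ 36 ℤ.* + (2 ℕ.^ e)) ℚ.* s                     ≡⟨ fromℤ-homo-* (+ 36 ℤ.* + (2 ℕ.^ e)) ((ℤ.- + 324) ℤ.^ q) ⟨
        fromℤ (+ 36 ℤ.* + (2 ℕ.^ e) ℤ.* (ℤ.- + 324) ℤ.^ q)     ≡⟨ cong fromℤ (36*2^[n∸[2+4q]]*[-324]^q≡2*sgn[q]*2^[n∸[1+2q]]*3^[2+4q] q j≤n) ⟩
        fromℤ (+ 2 ℤ.* K)                                      ≡⟨ fromℤ-homo-* (+ 2) K ⟩
        fromℤ (+ 2) ℚ.* fromℤ K                                ≡⟨ cong (ℚ._* fromℤ K) (BernoulliNumbers.⟦⟧≡fromℤ 2) ⟨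
        ℚ′.⟦ 2 ⟧ ℚ.* fromℤ K                                   ∎

    X-vs-Y : ∀ {n} j → j ℕ.≤ n →
      ℚ′.⟦ 2 ⟧ ℚ′.^ (n ∸ j) ℚ.* im (X ^ j) ≡ ℚ′.⟦ 2 ⟧ ℚ′.^ (n ∸ j) ℚ.* im (Y ^ j) ℚ.+ ℚ′.⟦ 2 ⟧ ℚ.* lhsWeight n j
    X-vs-Y {n} = divMod-elim P 4 P[r+4q]
      where
      P : ℕ → Set
      P j = j ℕ.≤ n → ℚ′.⟦ 2 ⟧ ℚ′.^ (n ∸ j) ℚ.* im (X ^ j) ≡ ℚ′.⟦ 2 ⟧ ℚ′.^ (n ∸ j) ℚ.* im (Y ^ j) ℚ.+ ℚ′.⟦ 2 ⟧ ℚ.* lhsWeight n j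
      same-im : ∀ r q → r ℕ.< 4 → im (X ^ r) ≡ im (Y ^ r) → lhsWeight n (r ℕ.+ q ℕ.* 4) ≡ 0ℚ → P (r ℕ.+ q ℕ.* 4)
      same-im r q _ im-Xʳ≡im-Yʳ weight≡0 _ = begin
        E ℚ.* im (X ^ j)
          ≡⟨ cong (E ℚ.*_) (im-^-r+4q {X} {ℤ.- + 324} X⁴≡-324 r q) ⟩
        E ℚ.* (im (X ^ r) ℚ.* s)
          ≡⟨ cong (λ x → E ℚ.* (x ℚ.* s)) im-Xʳ≡im-Yʳ ⟩
        E ℚ.* (im (Y ^ r) ℚ.* s)
          ≡⟨ solve 3 (λ e y s → e :* (y :* s) := e :* (y :* s) :+ con ℚ′.⟦ 2 ⟧ :* con 0ℚ) refl E (im (Y ^ r)) s ⟩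
        E ℚ.* (im (Y ^ r) ℚ.* s) ℚ.+ ℚ′.⟦ 2 ⟧ ℚ.* 0ℚ
          ≡⟨ cong₂ (λ x w → E ℚ.* x ℚ.+ ℚ′.⟦ 2 ⟧ ℚ.* w) (im-^-r+4q {Y} {ℤ.- + 324} Y⁴≡-324 r q) weight≡0 ⟨
        E ℚ.* im (Y ^ j) ℚ.+ ℚ′.⟦ 2 ⟧ ℚ.* lhsWeight n j  ∎
        where
        open ℚ-Solver using (solve; _:=_; _:+_; _:*_; _:-_; :-_; con)
        j = r ℕ.+ q ℕ.* 4
        E = ℚ′.⟦ 2 ⟧ ℚ′.^ (n ∸ j)
        s = fromℤ ((ℤ.- + 324) ℤ.^ q)
      P[r+4q] : ∀ r q → r ℕ.< 4 → P (r ℕ.+ q ℕ.* 4)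
      P[r+4q] 0 q r<4 = same-im 0 q r<4 refl (lhsWeight-mod {n} {0 ℕ.+ q ℕ.* 4} ([r+4q]%4≡r 0 q r<4))
      P[r+4q] 1 q r<4 = same-im 1 q r<4 refl (lhsWeight-mod {n} {1 ℕ.+ q ℕ.* 4} ([r+4q]%4≡r 1 q r<4))
      P[r+4q] 2 q r<4 j≤n = trans (X-vs-Y-2mod4 q j≤n) (cong (λ w → E ℚ.* im (Y ^ j) ℚ.+ ℚ′.⟦ 2 ⟧ ℚ.* w) (sym (lhsWeight-mod {n} {j} ([r+4q]%4≡r 2 q r<4))))
        where
        j = 2 ℕ.+ q ℕ.* 4
        E = ℚ′.⟦ 2 ⟧ ℚ′.^ (n ∸ j)
      P[r+4q] 3 q r<4 = same-im 3 q r<4 refl (lhsWeight-mod {n} {3 ℕ.+ q ℕ.* 4} ([r+4q]%4≡r 3 q r<4))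
      P[r+4q] (suc (suc (suc (suc _)))) _ (ℕ.s≤s (ℕ.s≤s (ℕ.s≤s (ℕ.s≤s ()))))

  coefficient-X-vs-Y : ∀ {n} j → j ℕ.≤ n →
    coefficient n j ℚ.* im (X ^ j) ≡ coefficient n j ℚ.* im (Y ^ j) ℚ.+ ℚ′.⟦ 2 ⟧ ℚ.* lhsTerm n j
  coefficient-X-vs-Y {n} j j≤n = begin
    c ℚ.* b ℚ.* E ℚ.* im (X ^ j)
      ≡⟨ solve 4 (λ c b e x → c :* b :* e :* x := c :* b :* (e :* x)) refl c b E (im (X ^ j)) ⟩
    c ℚ.* b ℚ.* (E ℚ.* im (X ^ j))
      ≡⟨ cong (c ℚ.* b ℚ.*_) (X-vs-Y j j≤n) ⟩
    c ℚ.* b ℚ.* (E ℚ.* im (Y ^ j) ℚ.+ ℚ′.⟦ 2 ⟧ ℚ.* w)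
      ≡⟨ solve 5 (λ c b e y w → c :* b :* (e :* y :+ con ℚ′.⟦ 2 ⟧ :* w) := c :* b :* e :* y :+ con ℚ′.⟦ 2 ⟧ :* (c :* w :* b)) refl c b E (im (Y ^ j)) w ⟩
    c ℚ.* b ℚ.* E ℚ.* im (Y ^ j) ℚ.+ ℚ′.⟦ 2 ⟧ ℚ.* (c ℚ.* w ℚ.* b)
      ≡⟨ cong (λ t → c ℚ.* b ℚ.* E ℚ.* im (Y ^ j) ℚ.+ ℚ′.⟦ 2 ⟧ ℚ.* t) (lhsTerm≡⟦C⟧*lhsWeight*B n j) ⟨
    c ℚ.* b ℚ.* E ℚ.* im (Y ^ j) ℚ.+ ℚ′.⟦ 2 ⟧ ℚ.* lhsTerm n j  ∎
    where
    open ℚ-Solver using (solve; _:=_; _:+_; _:*_; _:-_; :-_; con)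
    c = ℚ′.⟦ n C j ⟧
    b = B (n ∸ j)
    E = ℚ′.⟦ 2 ⟧ ℚ′.^ (n ∸ j)
    w = lhsWeight n j

  ∑X≡∑Y+⟦2⟧*LHS : ∀ n → ℚ′.∑ℕ (suc n) (λ j → coefficient n j ℚ.* im (X ^ j))
                      ≡ ℚ′.∑ℕ (suc n) (λ j → coefficient n j ℚ.* im (Y ^ j)) ℚ.+ ℚ′.⟦ 2 ⟧ ℚ.* LHS n
  ∑X≡∑Y+⟦2⟧*LHS n = begin
    ℚ′.∑ℕ (suc n) (λ j → coefficient n j ℚ.* im (X ^ j))
      ≡⟨ ℚ′.∑ℕ-cong (λ {j} j<1+n → coefficient-X-vs-Y j (ℕ.≤-pred j<1+n)) ⟩
    ℚ′.∑ℕ (suc n) (λ j → coefficient n j ℚ.* im (Y ^ j) ℚ.+ ℚ′.⟦ 2 ⟧ ℚ.* lhsTerm n j)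
      ≡⟨ ℚ′.∑ℕ-distrib-+ (suc n) _ _ ⟩
    ∑Y ℚ.+ ℚ′.∑ℕ (suc n) (λ j → ℚ′.⟦ 2 ⟧ ℚ.* lhsTerm n j)
      ≡⟨ cong (∑Y ℚ.+_) (ℚ′.*-distribˡ-∑ℕ (suc n) ℚ′.⟦ 2 ⟧ (lhsTerm n)) ⟨
    ∑Y ℚ.+ ℚ′.⟦ 2 ⟧ ℚ.* ℚ′.∑ℕ (suc n) (lhsTerm n)
      ≡⟨ cong (λ s → ∑Y ℚ.+ ℚ′.⟦ 2 ⟧ ℚ.* s) (ℚ′.∑ℕ-applyUpTo (lhsTerm n) (λ k → k) (suc n)) ⟨
    ∑Y ℚ.+ ℚ′.⟦ 2 ⟧ ℚ.* LHS n                                                  ∎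
    where
    ∑Y = ℚ′.∑ℕ (suc n) (λ j → coefficient n j ℚ.* im (Y ^ j))


  private
    shift-term : ℕ → ℚ[i] → ℚ
    shift-term m w = ℚ′.⟦ suc m ⟧ ℚ.* (ℚ′.⟦ 2 ⟧ ℚ.* im (w ^ m))

  ⟦2⟧*LHS≡shift-terms : ∀ m → ℚ′.⟦ 2 ⟧ ℚ.* LHS (suc m) ≡ shift-term m Y ℚ.+ shift-term m W₁ ℚ.+ shift-term m W₂
  ⟦2⟧*LHS≡shift-terms m = ∙-cancelˡ ∑Y _ _ (begin
    ∑Y ℚ.+ ℚ′.⟦ 2 ⟧ ℚ.* LHS n
      ≡⟨ ∑X≡∑Y+⟦2⟧*LHS n ⟨
    ℚ′.∑ℕ (suc n) (λ j → coefficient n j ℚ.* im (X ^ j))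
      ≡⟨ im-bernoulliPoly n X ⟨
    im (P X)
      ≡⟨ cong im telescope ⟩
    im (P Y) ℚ.+ im (T Y) ℚ.+ im (T W₁) ℚ.+ im (T W₂)
      ≡⟨ cong₂ (λ x y → x ℚ.+ y ℚ.+ im (T W₁) ℚ.+ im (T W₂)) (im-bernoulliPoly n Y) (im-⟦⟧*⟦2⟧* n (Y ^ m)) ⟩
    ∑Y ℚ.+ shift-term m Y ℚ.+ im (T W₁) ℚ.+ im (T W₂)
      ≡⟨ cong₂ (λ x y → ∑Y ℚ.+ shift-term m Y ℚ.+ x ℚ.+ y) (im-⟦⟧*⟦2⟧* n (W₁ ^ m)) (im-⟦⟧*⟦2⟧* n (W₂ ^ m)) ⟩
    ∑Y ℚ.+ shift-term m Y ℚ.+ shift-term m W₁ ℚ.+ shift-term m W₂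
      ≡⟨ solve 4 (λ a b c d → a :+ b :+ c :+ d := a :+ (b :+ c :+ d)) refl ∑Y (shift-term m Y) (shift-term m W₁) (shift-term m W₂) ⟩
    ∑Y ℚ.+ (shift-term m Y ℚ.+ shift-term m W₁ ℚ.+ shift-term m W₂)  ∎)
    where
    open ℚ-Solver using (solve; _:=_; _:+_; _:*_; _:-_; :-_; con)
    open import Algebra.Properties.Group ℚ.+-0-group using (∙-cancelˡ)
    n = suc m
    P = bernoulliPoly (ι ∘ B) n ⟦ 2 ⟧
    T : ℚ[i] → ℚ[i]
    T w = ⟦ n ⟧ * (⟦ 2 ⟧ * w ^ m)
    ∑Y = ℚ′.∑ℕ (suc n) (λ j → coefficient n j ℚ.* im (Y ^ j))
    shift = bernoulliPoly-shift ιB-isBernoulli m ⟦ 2 ⟧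
    telescope : P X ≡ P Y + T Y + T W₁ + T W₂
    telescope = begin
      P X                          ≡⟨ shift W₂ ⟩
      P W₂ + T W₂                  ≡⟨ cong (_+ T W₂) (shift W₁) ⟩
      P W₁ + T W₁ + T W₂           ≡⟨ cong (λ z → z + T W₁ + T W₂) (shift Y) ⟩
      P Y + T Y + T W₁ + T W₂      ∎

  im-W₂^≡U*3 : ∀ m → im (W₂ ^ m) ≡ fromℤ (U (+ 2) (+ 10) m) ℚ.* fromℤ (+ 3)
  im-W₂^≡U*3 = im-^-lucas {W₂} {+ 2} {+ 10} refl

  im-W₁^[1+2p]≡im-W₂^[1+2p] : ∀ p → im (W₁ ^ suc (p ℕ.* 2)) ≡ im (W₂ ^ suc (p ℕ.* 2))
  im-W₁^[1+2p]≡im-W₂^[1+2p] p = trans (cong im ([-conj]^odd W₂ p)) (im-‿conj (W₂ ^ suc (p ℕ.* 2)))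

  ⟦2⟧*RHS : ∀ p → let n = 2 ℕ.+ p ℕ.* 2 in
    ℚ′.⟦ 2 ⟧ ℚ.* RHS n
      ≡ ℚ′.⟦ n ⟧ ℚ.* (fromℤ (sgn (p ℕ.* 2 ℕ./ 4) ℤ.* + (2 ℕ.^ suc p ℕ.* 3 ℕ.^ suc (p ℕ.* 2)))
                      ℚ.+ fromℤ (+ 12) ℚ.* fromℤ (U (+ 2) (+ 10) (suc (p ℕ.* 2))))
  ⟦2⟧*RHS p = begin
    ℚ′.⟦ 2 ⟧ ℚ.* ((+ n ℚ./ 2) ℚ.* fromℤ (Z (n ℕ./ 2)))
      ≡⟨ cong₂ (λ h k → ℚ′.⟦ 2 ⟧ ℚ.* (h ℚ.* fromℤ (Z k))) (/-≡-fromℤ-* (+ n) 1) (m*n/n≡m (suc p) 2) ⟩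
    ℚ′.⟦ 2 ⟧ ℚ.* (fromℤ (+ n) ℚ.* ℚ.½ ℚ.* fromℤ (Z (suc p)))
      ≡⟨ solve 2 (λ a z → con ℚ′.⟦ 2 ⟧ :* (a :* con ℚ.½ :* z) := a :* z) refl (fromℤ (+ n)) (fromℤ (Z (suc p))) ⟩
    fromℤ (+ n) ℚ.* fromℤ (Z (suc p))
      ≡⟨ cong₂ ℚ._*_ (BernoulliNumbers.⟦⟧≡fromℤ n) (sym (trans (fromℤ-homo-+ Sg (+ 12 ℤ.* u)) (cong (fromℤ Sg ℚ.+_) (fromℤ-homo-* (+ 12) u)))) ⟨
    ℚ′.⟦ n ⟧ ℚ.* (fromℤ Sg ℚ.+ fromℤ (+ 12) ℚ.* fromℤ u)                ∎
    where
    open ℚ-Solver using (solve; _:=_; _:+_; _:*_; con)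
    n = 2 ℕ.+ p ℕ.* 2
    u = U (+ 2) (+ 10) (suc (p ℕ.* 2))
    Sg = sgn (p ℕ.* 2 ℕ./ 4) ℤ.* + (2 ℕ.^ suc p ℕ.* 3 ℕ.^ suc (p ℕ.* 2))
    Z : ℕ → ℤ
    Z k = sgn (p ℕ.* 2 ℕ./ 4) ℤ.* + (2 ℕ.^ k ℕ.* 3 ℕ.^ suc (p ℕ.* 2)) ℤ.+ + 12 ℤ.* u

  LHS≡RHS-even : ∀ p → LHS (2 ℕ.+ p ℕ.* 2) ≡ RHS (2 ℕ.+ p ℕ.* 2)
  LHS≡RHS-even p = begin
    LHS n                                  ≡⟨ solve 1 (λ x → x := con ℚ.½ :* (con ℚ′.⟦ 2 ⟧ :* x)) refl (LHS n) ⟩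
    ℚ.½ ℚ.* (ℚ′.⟦ 2 ⟧ ℚ.* LHS n)           ≡⟨ cong (ℚ.½ ℚ.*_) doubled ⟩
    ℚ.½ ℚ.* (ℚ′.⟦ 2 ⟧ ℚ.* RHS n)           ≡⟨ solve 1 (λ x → con ℚ.½ :* (con ℚ′.⟦ 2 ⟧ :* x) := x) refl (RHS n) ⟩
    RHS n                                  ∎
    where
    open ℚ-Solver using (solve; _:=_; _:+_; _:*_; con)
    m = suc (p ℕ.* 2)
    n = suc m
    u = fromℤ (U (+ 2) (+ 10) m)
    Sg = fromℤ (sgn (p ℕ.* 2 ℕ./ 4) ℤ.* + (2 ℕ.^ suc p ℕ.* 3 ℕ.^ m))
    doubled : ℚ′.⟦ 2 ⟧ ℚ.* LHS n ≡ ℚ′.⟦ 2 ⟧ ℚ.* RHS n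
    doubled = begin
      ℚ′.⟦ 2 ⟧ ℚ.* LHS n
        ≡⟨ ⟦2⟧*LHS≡shift-terms m ⟩
      shift-term m Y ℚ.+ shift-term m W₁ ℚ.+ shift-term m W₂
        ≡⟨ cong₂ (λ y w → ℚ′.⟦ n ⟧ ℚ.* y ℚ.+ ℚ′.⟦ n ⟧ ℚ.* (ℚ′.⟦ 2 ⟧ ℚ.* w) ℚ.+ shift-term m W₂)
          (⟦2⟧*im-Y^[1+2p] p) (im-W₁^[1+2p]≡im-W₂^[1+2p] p) ⟩
      ℚ′.⟦ n ⟧ ℚ.* Sg ℚ.+ shift-term m W₂ ℚ.+ shift-term m W₂
        ≡⟨ cong (λ w → ℚ′.⟦ n ⟧ ℚ.* Sg ℚ.+ ℚ′.⟦ n ⟧ ℚ.* (ℚ′.⟦ 2 ⟧ ℚ.* w) ℚ.+ ℚ′.⟦ n ⟧ ℚ.* (ℚ′.⟦ 2 ⟧ ℚ.* w)) (im-W₂^≡U*3 m) ⟩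
      ℚ′.⟦ n ⟧ ℚ.* Sg ℚ.+ ℚ′.⟦ n ⟧ ℚ.* (ℚ′.⟦ 2 ⟧ ℚ.* (u ℚ.* fromℤ (+ 3))) ℚ.+ ℚ′.⟦ n ⟧ ℚ.* (ℚ′.⟦ 2 ⟧ ℚ.* (u ℚ.* fromℤ (+ 3)))
        ≡⟨ solve 3 (λ a s u → a :* s :+ a :* (con ℚ′.⟦ 2 ⟧ :* (u :* con (fromℤ (+ 3)))) :+ a :* (con ℚ′.⟦ 2 ⟧ :* (u :* con (fromℤ (+ 3))))
                              := a :* (s :+ con (fromℤ (+ 12)) :* u)) refl ℚ′.⟦ n ⟧ Sg u ⟩
      ℚ′.⟦ n ⟧ ℚ.* (Sg ℚ.+ fromℤ (+ 12) ℚ.* u)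
        ≡⟨ ⟦2⟧*RHS p ⟨
      ℚ′.⟦ 2 ⟧ ℚ.* RHS n                                                     ∎

corollary2p7 : (n : ℕ) → 2 ≤ n → 2 ∣ n → LHS n ≡ RHS n
corollary2p7 _ () (divides zero ≡.refl)
corollary2p7 _ _ (divides (suc p) ≡.refl) = GaussianEvaluation.LHS≡RHS-even p
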